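{- As an identity of formal power series in $q, t_1, t_2$ (over a field of characteristic zero), \[ \sum_{n \geq 0} \sum_{\substack{j+k \geq n \\ 0\le j, k \leq n}} \frac{ (-1)^{j+k+n}\, t_1^j t_2^k\, q^{\binom{n}{2} + \binom{k+1}{2} + j^2-nj+j} \genfrac{[}{]}{0pt}{}{n}{n-j,\ n-k,\ j+k-n}_{q} }{(t_2q;q)_n\, (q;q)_n} = \frac{(-t_1q; q)_\infty}{(t_2q; q)_\infty}. \]
   Context: $(z;q)_0=1$, $(z;q)_n=\prod_{r=0}^{n-1}(1-zq^r)$ for $n>0$, and $(z;q)_\infty=\prod_{r\ge 0}(1-zq^r)$. For nonnegative integers $k_1,\dots,k_t$ with $k_1+\cdots+k_t=n$, the $q$-multinomial coefficient is $\genfrac{[}{]}{0pt}{}{n}{k_1,\dots,k_t}_q=\frac{(q;q)_n}{(q;q)_{k_1}\cdots(q;q)_{k_t}}$. -}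

module Defs where

open import Data.Nat as ℕ using (ℕ; zero; suc; _∸_; _≡ᵇ_; _≤ᵇ_)
open import Data.Integer using (ℤ; _+_; _*_; -_; 0ℤ; 1ℤ; -1ℤ)
open import Data.Bool using (if_then_else_; _∧_)

-- Formal power series in q, t₁, t₂ with integer coefficients:
-- F a b c is the coefficient of q^a t₁^b t₂^c.
Series : Set
Series = ℕ → ℕ → ℕ → ℤ

sumℤ : ℕ → (ℕ → ℤ) → ℤ
sumℤ zero    f = 0ℤ
sumℤ (suc n) f = sumℤ n f + f n

mono : ℤ → ℕ → ℕ → ℕ → Series
mono s e₁ e₂ e₃ a b c =
  if (a ≡ᵇ e₁) ∧ (b ≡ᵇ e₂) ∧ (c ≡ᵇ e₃) then s else 0ℤ

zeroS : Series
zeroS _ _ _ = 0ℤ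

oneS : Series
oneS = mono 1ℤ 0 0 0

_⊕_ : Series → Series → Series
(f ⊕ g) a b c = f a b c + g a b c

⊝_ : Series → Series
(⊝ f) a b c = - f a b c

_⊖_ : Series → Series → Series
f ⊖ g = f ⊕ (⊝ g)

_⊛_ : Series → Series → Series
(f ⊛ g) a b c =
  sumℤ (suc a) λ i → sumℤ (suc b) λ j → sumℤ (suc c) λ k →
    f i j k * g (a ∸ i) (b ∸ j) (c ∸ k)

infixl 6 _⊕_ _⊖_
infixl 7 _⊛_

powS : Series → ℕ → Series
powS f zero    = oneS
powS f (suc m) = powS f m ⊛ f

sumS : ℕ → (ℕ → Series) → Series
sumS n F a b c = sumℤ n λ i → F i a b c

-- Multiplicative inverse of a series f with constant term 1:
-- 1/f = Σ_{m ≥ 0} (1 - f)^m; since 1 - f has zero constant term, the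
-- coefficient of q^a t₁^b t₂^c only receives contributions from m ≤ a+b+c.
invS : Series → Series
invS f a b c = sumS (suc (a ℕ.+ b ℕ.+ c)) (powS (oneS ⊖ f)) a b c

poch : Series → ℕ → Series
poch z zero    = oneS
poch z (suc n) = poch z n ⊛ (oneS ⊖ z ⊛ mono 1ℤ n 0 0)

qS : Series
qS = mono 1ℤ 1 0 0

qMultinomial₃ : ℕ → ℕ → ℕ → ℕ → Series
qMultinomial₃ n k₁ k₂ k₃ =
  poch qS n ⊛ invS (poch qS k₁) ⊛ invS (poch qS k₂) ⊛ invS (poch qS k₃)

choose2 : ℕ → ℕ
choose2 m = (m ℕ.* (m ∸ 1)) ℕ./ 2

signℤ : ℕ → ℤ
signℤ zero    = 1ℤ
signℤ (suc m) = - signℤ m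

-- exponent binom(n,2) + binom(k+1,2) + j² - n j + j  (always ≥ 0 when j ≤ n)
expo : ℕ → ℕ → ℕ → ℕ
expo n j k = (choose2 n ℕ.+ choose2 (suc k) ℕ.+ j ℕ.* j ℕ.+ j) ∸ (n ℕ.* j)

summand : ℕ → ℕ → ℕ → Series
summand n j k =
  if n ≤ᵇ (j ℕ.+ k)
  then mono (signℤ (j ℕ.+ k ℕ.+ n)) (expo n j k) j k
         ⊛ qMultinomial₃ n (n ∸ j) (n ∸ k) (j ℕ.+ k ∸ n)
         ⊛ invS (poch (mono 1ℤ 1 0 1) n ⊛ poch qS n)
  else zeroS

lhsPartial : ℕ → Series
lhsPartial M = sumS M λ n → sumS (suc n) λ j → sumS (suc n) λ k → summand n j k

-- (-t₁q;q)_M / (t₂q;q)_M, whose limit is the right-hand side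
rhsPartial : ℕ → Series
rhsPartial M = poch (mono -1ℤ 1 1 0) M ⊛ invS (poch (mono 1ℤ 1 0 1) M)

-- Both sides agree, below any fixed total degree, with the double sum
--   Σ_{j,a} q^{C(j+1,2) + a²} t₁^j t₂^a / ((q;q)_j (q;q)_a (t₂q;q)_a).
-- On the left write n = j + a and k = a + c. For fixed j and a the sum over c collapses
-- to the (j, a) term, by the finite q-binomial theorem
-- (z;q)_j = Σ_c (-1)^c q^{C(c,2)} [j, c] z^c at z = t₂q^{a+1}, together with
-- (t₂q;q)_{j+a} = (t₂q;q)_a (t₂q^{a+1};q)_j. On the right the same theorem gives
-- (-t₁q;q)_M = Σ_j q^{C(j+1,2)} [M, j] t₁^j, and a finite Durfee identity gives
-- 1/(t₂q;q)_M = Σ_a q^{a²} [M, a] t₂^a / (t₂q;q)_a. Since (q;q)_j [M, j] = (q^{M-j+1};q)_j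
-- is 1 below degree M - j + 1, each [M, j] may be replaced by 1/(q;q)_j below degree M + 1.
-- The partial sums of the left side stabilise because its n-th term starts in degree n.

{-# OPTIONS --safe #-}
module Submission where

open import Defs
open import Data.Nat using (ℕ; _≤_)
open import Data.Integer using (ℤ)
open import Data.Product using (∃-syntax; _×_)
open import Relation.Binary.PropositionalEquality using (_≡_)

open import Data.Nat as N using (zero; suc; _∸_; _<_; z≤n; s≤s)
import Data.Nat.Properties as NP
import Data.Nat.Tactic.RingSolver as ℕ-Solver
open import Data.Nat.DivMod using (+-distrib-/-∣ʳ; m*n/n≡m)
open import Data.Nat.Divisibility using (n∣m*n)
import Data.Integer as Z
import Data.Integer.Properties as ZP
open import Data.Product using (_,_)
open import Data.Sum using (inj₁; inj₂)
open import Data.Bool using (true; false; if_then_else_; _∧_; T)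
open import Function using (case_of_)
open import Data.Empty using (⊥-elim)
open import Relation.Nullary using (yes; no)
open import Relation.Nullary.Decidable using (dec-true; dec-false)
import Relation.Binary.PropositionalEquality as P
open import Algebra.Bundles using (CommutativeRing)
import Algebra.Construct.Pointwise as Pointwise
import Algebra.Properties.CommutativeSemigroup as CommSemigroupProps
import Algebra.Properties.AbelianGroup as AbelianGroupProps
import Algebra.Properties.Group as GroupProps
import Relation.Binary.Reasoning.Setoid as SetoidReasoning
open import Relation.Binary.Bundles using (Setoid)

if-true : ∀ {a} {A : Set a} {b} {x y : A} → b ≡ true → (if b then x else y) ≡ x
if-true P.refl = P.refl

if-false : ∀ {a} {A : Set a} {b} {x y : A} → b ≡ false → (if b then x else y) ≡ y
if-false P.refl = P.refl

-- Finite sums in a commutative ring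
module FiniteSum {c ℓ} (R : CommutativeRing c ℓ) where
  open CommutativeRing R
  open SetoidReasoning setoid
  open CommSemigroupProps +-commutativeSemigroup using (interchange)
  open AbelianGroupProps +-abelianGroup using (⁻¹-∙-comm)
  open GroupProps +-group using (ε⁻¹≈ε)

  ∑ : ℕ → (ℕ → Carrier) → Carrier
  ∑ zero    F = 0#
  ∑ (suc n) F = ∑ n F + F n

  ∑-cong< : ∀ n {F G : ℕ → Carrier} → (∀ i → i < n → F i ≈ G i) → ∑ n F ≈ ∑ n G
  ∑-cong< zero    F≈G = refl
  ∑-cong< (suc n) F≈G = +-cong (∑-cong< n (λ i i<n → F≈G i (NP.m<n⇒m<1+n i<n))) (F≈G n (NP.n<1+n n))

  ∑-cong : ∀ n {F G : ℕ → Carrier} → (∀ i → F i ≈ G i) → ∑ n F ≈ ∑ n G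
  ∑-cong n F≈G = ∑-cong< n (λ i _ → F≈G i)

  ∑-zero : ∀ n {F : ℕ → Carrier} → (∀ i → i < n → F i ≈ 0#) → ∑ n F ≈ 0#
  ∑-zero n F≈0 = trans (∑-cong< n F≈0) (∑-zero-const n)
    where
    ∑-zero-const : ∀ n → ∑ n (λ _ → 0#) ≈ 0#
    ∑-zero-const zero    = refl
    ∑-zero-const (suc n) = trans (+-identityʳ _) (∑-zero-const n)

  ∑-single : ∀ n e (F : ℕ → Carrier) → e < n → (∀ i → i < n → i P.≢ e → F i ≈ 0#) → ∑ n F ≈ F e
  ∑-single (suc n) e F e<1+n F≈0 with NP.m≤n⇒m<n∨m≡n (NP.≤-pred e<1+n)
  ... | inj₁ e<n = trans (+-cong (∑-single n e F e<n (λ i i<n → F≈0 i (NP.m<n⇒m<1+n i<n)))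
                                 (F≈0 n (NP.n<1+n n) (λ n≡e → NP.<-irrefl (P.sym n≡e) e<n)))
                         (+-identityʳ _)
  ... | inj₂ P.refl = trans (+-congʳ (∑-zero n (λ i i<n → F≈0 i (NP.m<n⇒m<1+n i<n) (NP.<⇒≢ i<n))))
                            (+-identityˡ _)

  ∑-+ : ∀ n (F G : ℕ → Carrier) → ∑ n (λ i → F i + G i) ≈ ∑ n F + ∑ n G
  ∑-+ zero    F G = sym (+-identityˡ 0#)
  ∑-+ (suc n) F G = trans (+-congʳ (∑-+ n F G)) (interchange _ _ _ _)

  ∑-neg : ∀ n (F : ℕ → Carrier) → ∑ n (λ i → - F i) ≈ - ∑ n F
  ∑-neg zero    F = sym ε⁻¹≈ε
  ∑-neg (suc n) F = trans (+-congʳ (∑-neg n F)) (⁻¹-∙-comm (∑ n F) (F n))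

  ∑-*ˡ : ∀ n x (F : ℕ → Carrier) → x * ∑ n F ≈ ∑ n (λ i → x * F i)
  ∑-*ˡ zero    x F = zeroʳ x
  ∑-*ˡ (suc n) x F = trans (distribˡ x _ _) (+-congʳ (∑-*ˡ n x F))

  ∑-*ʳ : ∀ n x (F : ℕ → Carrier) → ∑ n F * x ≈ ∑ n (λ i → F i * x)
  ∑-*ʳ zero    x F = zeroˡ x
  ∑-*ʳ (suc n) x F = trans (distribʳ x _ _) (+-congʳ (∑-*ʳ n x F))

  ∑-unconsˡ : ∀ n (F : ℕ → Carrier) → ∑ (suc n) F ≈ F 0 + ∑ n (λ i → F (suc i))
  ∑-unconsˡ zero    F = +-comm 0# (F 0)
  ∑-unconsˡ (suc n) F = trans (+-congʳ (∑-unconsˡ n F)) (+-assoc _ _ _)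

  ∑-split : ∀ m n (F : ℕ → Carrier) → ∑ (m N.+ n) F ≈ ∑ m F + ∑ n (λ i → F (m N.+ i))
  ∑-split m zero    F rewrite NP.+-identityʳ m = sym (+-identityʳ _)
  ∑-split m (suc n) F rewrite NP.+-suc m n = trans (+-congʳ (∑-split m n F)) (+-assoc _ _ _)

  ∑-recurrence : ∀ n (F F′ G : ℕ → Carrier) → F′ 0 ≈ F 0 → (∀ i → i ≤ n → F′ (suc i) ≈ F (suc i) + G i) →
                 F (suc n) ≈ 0# → ∑ (suc (suc n)) F′ ≈ ∑ (suc n) F + ∑ (suc n) G
  ∑-recurrence n F F′ G F′₀≈F₀ F′≈F+G Fₙ₊₁≈0 = begin
    ∑ (suc (suc n)) F′
      ≈⟨ ∑-unconsˡ (suc n) F′ ⟩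
    F′ 0 + ∑ (suc n) (λ i → F′ (suc i))
      ≈⟨ +-cong F′₀≈F₀ (∑-cong< (suc n) (λ i i≤n → F′≈F+G i (NP.≤-pred i≤n))) ⟩
    F 0 + ∑ (suc n) (λ i → F (suc i) + G i)
      ≈⟨ +-congˡ (∑-+ (suc n) (λ i → F (suc i)) G) ⟩
    F 0 + (∑ (suc n) (λ i → F (suc i)) + ∑ (suc n) G)
      ≈⟨ +-assoc _ _ _ ⟨
    (F 0 + ∑ (suc n) (λ i → F (suc i))) + ∑ (suc n) G
      ≈⟨ +-congʳ (∑-unconsˡ (suc n) F) ⟨
    (∑ (suc n) F + F (suc n)) + ∑ (suc n) G
      ≈⟨ +-congʳ (trans (+-congˡ Fₙ₊₁≈0) (+-identityʳ _)) ⟩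
    ∑ (suc n) F + ∑ (suc n) G ∎

  ∑-reverse : ∀ n (F : ℕ → Carrier) → ∑ (suc n) F ≈ ∑ (suc n) (λ i → F (n ∸ i))
  ∑-reverse zero    F = refl
  ∑-reverse (suc n) F = begin
    ∑ (suc n) F + F (suc n)                       ≈⟨ +-congʳ (∑-reverse n F) ⟩
    ∑ (suc n) (λ i → F (n ∸ i)) + F (suc n)       ≈⟨ +-comm _ _ ⟩
    F (suc n) + ∑ (suc n) (λ i → F (n ∸ i))       ≈⟨ ∑-unconsˡ (suc n) (λ i → F (suc n ∸ i)) ⟨
    ∑ (suc (suc n)) (λ i → F (suc n ∸ i))         ∎

  ∑-triangle : ∀ n (F : ℕ → ℕ → Carrier) →
    ∑ (suc n) (λ i → ∑ (suc i) (λ j → F i j)) ≈ ∑ (suc n) (λ j → ∑ (suc (n ∸ j)) (λ l → F (j N.+ l) j))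
  ∑-triangle zero    F = refl
  ∑-triangle (suc n) F = begin
    ∑ (suc n) (λ i → ∑ (suc i) (F i)) + (∑ (suc n) (F (suc n)) + F (suc n) (suc n))
      ≈⟨ +-congʳ (∑-triangle n F) ⟩
    ∑ (suc n) (λ j → column n j) + (∑ (suc n) (F (suc n)) + F (suc n) (suc n))
      ≈⟨ +-assoc _ _ _ ⟨
    (∑ (suc n) (λ j → column n j) + ∑ (suc n) (F (suc n))) + F (suc n) (suc n)
      ≈⟨ +-cong (∑-+ (suc n) _ _) (column-diagonal (suc n)) ⟨
    ∑ (suc n) (λ j → column n j + F (suc n) j) + column (suc n) (suc n)
      ≈⟨ +-congʳ (∑-cong< (suc n) (λ j j≤n → column-suc j (NP.≤-pred j≤n))) ⟩
    ∑ (suc (suc n)) (λ j → column (suc n) j) ∎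
    where
    column : ℕ → ℕ → Carrier
    column n j = ∑ (suc (n ∸ j)) (λ l → F (j N.+ l) j)
    column-diagonal : ∀ n → column n n ≈ F n n
    column-diagonal n rewrite NP.n∸n≡0 n | NP.+-identityʳ n = +-identityˡ _
    column-suc : ∀ j → j ≤ n → column n j + F (suc n) j ≈ column (suc n) j
    column-suc j j≤n rewrite NP.+-∸-assoc 1 j≤n = +-congˡ (reflexive (P.cong (λ i → F i j) last-index))
      where
      last-index : suc n ≡ j N.+ suc (n ∸ j)
      last-index = P.trans (P.cong suc (P.sym (NP.m+[n∸m]≡n j≤n))) (P.sym (NP.+-suc j (n ∸ j)))

-- Power series in one variable
module PowerSeries {c ℓ} (R : CommutativeRing c ℓ) where
  open CommutativeRing R
  open FiniteSum R
  open SetoidReasoning setoid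

  PS : Set c
  PS = ℕ → Carrier

  _≈ₚ_ : PS → PS → Set ℓ
  f ≈ₚ g = ∀ n → f n ≈ g n

  _+ₚ_ : PS → PS → PS
  (f +ₚ g) n = f n + g n

  _*ₚ_ : PS → PS → PS
  (f *ₚ g) n = ∑ (suc n) (λ i → f i * g (n ∸ i))

  1ₚ : PS
  1ₚ zero    = 1#
  1ₚ (suc _) = 0#

  *ₚ-cong : ∀ {f f′ g g′} → f ≈ₚ f′ → g ≈ₚ g′ → (f *ₚ g) ≈ₚ (f′ *ₚ g′)
  *ₚ-cong f≈f′ g≈g′ n = ∑-cong (suc n) (λ i → *-cong (f≈f′ i) (g≈g′ (n ∸ i)))

  *ₚ-comm : ∀ f g → (f *ₚ g) ≈ₚ (g *ₚ f)
  *ₚ-comm f g n = trans (∑-reverse n _) (∑-cong< (suc n) (λ i i≤n →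
    trans (*-comm _ _) (*-congʳ (reflexive (P.cong g (NP.m∸[m∸n]≡n (NP.≤-pred i≤n)))))))

  *ₚ-identityˡ : ∀ f → (1ₚ *ₚ f) ≈ₚ f
  *ₚ-identityˡ f n = begin
    ∑ (suc n) (λ i → 1ₚ i * f (n ∸ i))            ≈⟨ ∑-unconsˡ n _ ⟩
    1# * f n + ∑ n (λ i → 0# * f (n ∸ suc i))    ≈⟨ +-cong (*-identityˡ (f n)) (∑-zero n (λ i _ → zeroˡ _)) ⟩
    f n + 0#                                     ≈⟨ +-identityʳ _ ⟩
    f n                                          ∎

  *ₚ-distribˡ : ∀ h f g → (h *ₚ (f +ₚ g)) ≈ₚ ((h *ₚ f) +ₚ (h *ₚ g))
  *ₚ-distribˡ h f g n = trans (∑-cong (suc n) (λ i → distribˡ _ _ _)) (∑-+ (suc n) _ _)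

  *ₚ-distribʳ : ∀ h f g → ((f +ₚ g) *ₚ h) ≈ₚ ((f *ₚ h) +ₚ (g *ₚ h))
  *ₚ-distribʳ h f g n = trans (∑-cong (suc n) (λ i → distribʳ _ _ _)) (∑-+ (suc n) _ _)

  *ₚ-assoc : ∀ f g h → ((f *ₚ g) *ₚ h) ≈ₚ (f *ₚ (g *ₚ h))
  *ₚ-assoc f g h n = begin
    ∑ (suc n) (λ i → ∑ (suc i) (λ j → f j * g (i ∸ j)) * h (n ∸ i))
      ≈⟨ ∑-cong (suc n) (λ i → ∑-*ʳ (suc i) _ _) ⟩
    ∑ (suc n) (λ i → ∑ (suc i) (λ j → f j * g (i ∸ j) * h (n ∸ i)))
      ≈⟨ ∑-triangle n _ ⟩
    ∑ (suc n) (λ j → ∑ (suc (n ∸ j)) (λ l → f j * g (j N.+ l ∸ j) * h (n ∸ (j N.+ l))))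
      ≈⟨ ∑-cong (suc n) (λ j → ∑-cong (suc (n ∸ j)) (λ l → trans (*-assoc _ _ _)
           (*-congˡ (*-cong (reflexive (P.cong g (NP.m+n∸m≡n j l)))
                            (reflexive (P.cong h (P.sym (NP.∸-+-assoc n j l)))))))) ⟩
    ∑ (suc n) (λ j → ∑ (suc (n ∸ j)) (λ l → f j * (g l * h (n ∸ j ∸ l))))
      ≈⟨ ∑-cong (suc n) (λ j → ∑-*ˡ (suc (n ∸ j)) _ _) ⟨
    ∑ (suc n) (λ j → f j * ∑ (suc (n ∸ j)) (λ l → g l * h (n ∸ j ∸ l))) ∎

  powerSeriesRing : CommutativeRing c ℓ
  powerSeriesRing = record
    { _≈_ = _≈ₚ_
    ; _+_ = _+ₚ_
    ; _*_ = _*ₚ_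
    ; -_  = λ f n → - f n
    ; 0#  = λ _ → 0#
    ; 1#  = 1ₚ
    ; isCommutativeRing = record
      { isRing = record
        { +-isAbelianGroup = Pointwise.isAbelianGroup ℕ +-isAbelianGroup
        ; *-cong           = *ₚ-cong
        ; *-assoc          = *ₚ-assoc
        ; *-identity       = *ₚ-identityˡ , λ f n → trans (*ₚ-comm f 1ₚ n) (*ₚ-identityˡ f n)
        ; distrib          = *ₚ-distribˡ , *ₚ-distribʳ
        }
      ; *-comm = *ₚ-comm
      }
    }

  δ : ℕ → Carrier → PS
  δ a r n = if n N.≡ᵇ a then r else 0#

  δ-cong : ∀ a {r s} → r ≈ s → δ a r ≈ₚ δ a s
  δ-cong a r≈s n with n N.≡ᵇ a
  ... | true  = r≈s
  ... | false = refl

  δ-≡ : ∀ a r → δ a r a ≈ r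
  δ-≡ a r = reflexive (if-true (dec-true (a N.≟ a) P.refl))

  δ-≢ : ∀ a i r → i P.≢ a → δ a r i ≈ 0#
  δ-≢ a i r i≢a = reflexive (if-false (dec-false (i N.≟ a) i≢a))

  private
    ≡ᵇ-shift : ∀ {a n} b → a ≤ n → (n N.≡ᵇ a N.+ b) ≡ (n ∸ a N.≡ᵇ b)
    ≡ᵇ-shift {a} {n} b a≤n with n ∸ a N.≟ b
    ... | yes n∸a≡b = P.trans
      (dec-true (n N.≟ a N.+ b) (P.trans (P.sym (NP.m+[n∸m]≡n a≤n)) (P.cong (a N.+_) n∸a≡b)))
      (P.sym (dec-true (n ∸ a N.≟ b) n∸a≡b))
    ... | no  n∸a≢b = P.trans
      (dec-false (n N.≟ a N.+ b) (λ n≡a+b → n∸a≢b (P.trans (P.cong (_∸ a) n≡a+b) (NP.m+n∸m≡n a b))))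
      (P.sym (dec-false (n ∸ a N.≟ b) n∸a≢b))

  δ-*ₚ-δ : ∀ a b r s → (δ a r *ₚ δ b s) ≈ₚ δ (a N.+ b) (r * s)
  δ-*ₚ-δ a b r s n with a N.≤? n
  ... | yes a≤n = begin
      ∑ (suc n) (λ i → δ a r i * δ b s (n ∸ i))
        ≈⟨ ∑-single (suc n) a _ (s≤s a≤n) (λ i _ i≢a → trans (*-congʳ (δ-≢ a i r i≢a)) (zeroˡ _)) ⟩
      δ a r a * δ b s (n ∸ a)
        ≈⟨ *-congʳ (δ-≡ a r) ⟩
      r * δ b s (n ∸ a)
        ≈⟨ *-if ((n ∸ a) N.≡ᵇ b) ⟩
      (if (n ∸ a) N.≡ᵇ b then r * s else 0#)
        ≡⟨ P.cong (λ t → if t then r * s else 0#) (≡ᵇ-shift b a≤n) ⟨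
      δ (a N.+ b) (r * s) n ∎
    where
    *-if : ∀ t → r * (if t then s else 0#) ≈ (if t then r * s else 0#)
    *-if true  = refl
    *-if false = zeroʳ r
  ... | no a≰n = trans
      (∑-zero (suc n) (λ i i≤n →
        trans (*-congʳ (δ-≢ a i r (λ { P.refl → a≰n (NP.≤-pred i≤n) }))) (zeroˡ _)))
      (sym (δ-≢ (a N.+ b) n (r * s) (λ n≡a+b → a≰n (P.subst (a ≤_) (P.sym n≡a+b) (NP.m≤m+n a b)))))

  module ∑ₚ = FiniteSum powerSeriesRing

  ∑ₚ-coeff : ∀ n (F : ℕ → PS) k → ∑ₚ.∑ n F k ≡ ∑ n (λ i → F i k)
  ∑ₚ-coeff zero    F k = P.refl
  ∑ₚ-coeff (suc n) F k = P.cong (_+ F n k) (∑ₚ-coeff n F k)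

-- Series is definitionally ℤ[[t₂]][[t₁]][[q]], built by iterating PowerSeries, with the
-- same addition; _⊛_ agrees with the iterated Cauchy product, which yields the ring laws.
module PS₁ = PowerSeries ZP.+-*-commutativeRing
module PS₂ = PowerSeries PS₁.powerSeriesRing
module PS₃ = PowerSeries PS₂.powerSeriesRing
module R₃ = CommutativeRing PS₃.powerSeriesRing

infix 4 _≋_
_≋_ : Series → Series → Set
_≋_ = PS₃._≈ₚ_

∑ℤ≡sumℤ : ∀ n F → FiniteSum.∑ ZP.+-*-commutativeRing n F ≡ sumℤ n F
∑ℤ≡sumℤ zero    F = P.refl
∑ℤ≡sumℤ (suc n) F = P.cong (Z._+ F n) (∑ℤ≡sumℤ n F)

sumℤ-cong : ∀ n {F G : ℕ → ℤ} → (∀ i → F i ≡ G i) → sumℤ n F ≡ sumℤ n G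
sumℤ-cong zero    F≡G = P.refl
sumℤ-cong (suc n) F≡G = P.cong₂ Z._+_ (sumℤ-cong n F≡G) (F≡G n)

sumℤ-cong< : ∀ n {F G : ℕ → ℤ} → (∀ i → i < n → F i ≡ G i) → sumℤ n F ≡ sumℤ n G
sumℤ-cong< zero    F≡G = P.refl
sumℤ-cong< (suc n) F≡G = P.cong₂ Z._+_ (sumℤ-cong< n (λ i i<n → F≡G i (NP.m<n⇒m<1+n i<n))) (F≡G n (NP.n<1+n n))

sumℤ-zero : ∀ n {F : ℕ → ℤ} → (∀ i → i < n → F i ≡ Z.0ℤ) → sumℤ n F ≡ Z.0ℤ
sumℤ-zero zero    F≡0 = P.refl
sumℤ-zero (suc n) F≡0 = P.cong₂ Z._+_ (sumℤ-zero n (λ i i<n → F≡0 i (NP.m<n⇒m<1+n i<n))) (F≡0 n (NP.n<1+n n))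

sumℤ-extend : ∀ n d (F : ℕ → ℤ) → (∀ i → n ≤ i → F i ≡ Z.0ℤ) → sumℤ (n N.+ d) F ≡ sumℤ n F
sumℤ-extend n zero    F F≡0 rewrite NP.+-identityʳ n = P.refl
sumℤ-extend n (suc d) F F≡0 rewrite NP.+-suc n d =
  P.trans (P.cong₂ Z._+_ (sumℤ-extend n d F F≡0) (F≡0 (n N.+ d) (NP.m≤m+n n d))) (ZP.+-identityʳ _)

⊛-nested : ∀ f g → (f ⊛ g) ≋ PS₃._*ₚ_ f g
⊛-nested f g a b c = P.sym (begin
  PS₃._*ₚ_ f g a b c
    ≡⟨ P.cong (λ h → h c) (PS₂.∑ₚ-coeff (suc a) (λ i → PS₂._*ₚ_ (f i) (g (a ∸ i))) b) ⟩
  PS₁.∑ₚ.∑ (suc a) (λ i → PS₂._*ₚ_ (f i) (g (a ∸ i)) b) c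
    ≡⟨ PS₁.∑ₚ-coeff (suc a) _ c ⟩
  FiniteSum.∑ ZP.+-*-commutativeRing (suc a) (λ i → PS₂._*ₚ_ (f i) (g (a ∸ i)) b c)
    ≡⟨ ∑ℤ≡sumℤ (suc a) _ ⟩
  sumℤ (suc a) (λ i → PS₂._*ₚ_ (f i) (g (a ∸ i)) b c)
    ≡⟨ sumℤ-cong (suc a) (λ i → P.trans (PS₁.∑ₚ-coeff (suc b) _ c) (P.trans (∑ℤ≡sumℤ (suc b) _)
         (sumℤ-cong (suc b) (λ j → ∑ℤ≡sumℤ (suc c) _)))) ⟩
  (f ⊛ g) a b c ∎)
  where open P.≡-Reasoning

oneS≋1ₚ : oneS ≋ PS₃.1ₚ
oneS≋1ₚ zero    zero    zero    = P.refl
oneS≋1ₚ zero    zero    (suc c) = P.refl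
oneS≋1ₚ zero    (suc b) c       = P.refl
oneS≋1ₚ (suc a) b       c       = P.refl

-- An opaque copy of _⊛_: it keeps the type checker from unfolding Cauchy sums
-- whenever it compares two products.
opaque
  infixl 7 _·_
  _·_ : Series → Series → Series
  _·_ = _⊛_

  ⊛≡· : ∀ f g → f ⊛ g ≡ f · g
  ⊛≡· f g = P.refl

·-nested : ∀ f g → (f · g) ≋ PS₃._*ₚ_ f g
·-nested f g = P.subst (_≋ PS₃._*ₚ_ f g) (⊛≡· f g) (⊛-nested f g)

module _ where
  open SetoidReasoning R₃.setoid

  ·-cong : ∀ {f f′ g g′} → f ≋ f′ → g ≋ g′ → (f · g) ≋ (f′ · g′)
  ·-cong {f} {f′} {g} {g′} f≋f′ g≋g′ = begin
    f · g               ≈⟨ ·-nested f g ⟩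
    PS₃._*ₚ_ f g        ≈⟨ R₃.*-cong f≋f′ g≋g′ ⟩
    PS₃._*ₚ_ f′ g′      ≈⟨ ·-nested f′ g′ ⟨
    f′ · g′             ∎

  ·-comm : ∀ f g → (f · g) ≋ (g · f)
  ·-comm f g = begin
    f · g               ≈⟨ ·-nested f g ⟩
    PS₃._*ₚ_ f g        ≈⟨ R₃.*-comm f g ⟩
    PS₃._*ₚ_ g f        ≈⟨ ·-nested g f ⟨
    g · f               ∎

  ·-assoc : ∀ f g h → ((f · g) · h) ≋ (f · (g · h))
  ·-assoc f g h = begin
    (f · g) · h                         ≈⟨ ·-nested (f · g) h ⟩
    PS₃._*ₚ_ (f · g) h                  ≈⟨ R₃.*-cong (·-nested f g) (R₃.refl {h}) ⟩
    PS₃._*ₚ_ (PS₃._*ₚ_ f g) h           ≈⟨ R₃.*-assoc f g h ⟩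
    PS₃._*ₚ_ f (PS₃._*ₚ_ g h)           ≈⟨ R₃.*-cong (R₃.refl {f}) (·-nested g h) ⟨
    PS₃._*ₚ_ f (g · h)                  ≈⟨ ·-nested f (g · h) ⟨
    f · (g · h)                         ∎

  ·-identityˡ : ∀ f → (oneS · f) ≋ f
  ·-identityˡ f = begin
    oneS · f                  ≈⟨ ·-nested oneS f ⟩
    PS₃._*ₚ_ oneS f           ≈⟨ R₃.*-cong oneS≋1ₚ (R₃.refl {f}) ⟩
    PS₃._*ₚ_ PS₃.1ₚ f         ≈⟨ R₃.*-identityˡ f ⟩
    f                         ∎

  ·-distribˡ : ∀ h f g → (h · (f ⊕ g)) ≋ ((h · f) ⊕ (h · g))
  ·-distribˡ h f g = begin
    h · (f ⊕ g)                               ≈⟨ ·-nested h (f ⊕ g) ⟩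
    PS₃._*ₚ_ h (f ⊕ g)                        ≈⟨ R₃.distribˡ h f g ⟩
    PS₃._*ₚ_ h f ⊕ PS₃._*ₚ_ h g               ≈⟨ R₃.+-cong (·-nested h f) (·-nested h g) ⟨
    (h · f) ⊕ (h · g)                         ∎

seriesRing : CommutativeRing _ _
seriesRing = record
  { _≈_ = _≋_
  ; _+_ = _⊕_
  ; _*_ = _·_
  ; -_  = ⊝_
  ; 0#  = zeroS
  ; 1#  = oneS
  ; isCommutativeRing = record
    { isRing = record
      { +-isAbelianGroup = R₃.+-isAbelianGroup
      ; *-cong     = ·-cong
      ; *-assoc    = ·-assoc
      ; *-identity = ·-identityˡ , λ f → R₃.trans (·-comm f oneS) (·-identityˡ f)
      ; distrib    = ·-distribˡ , λ h f g → R₃.trans (·-comm (f ⊕ g) h)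
                                     (R₃.trans (·-distribˡ h f g) (R₃.+-cong (·-comm h f) (·-comm h g)))
      }
    ; *-comm = ·-comm
    }
  }

module S = CommutativeRing seriesRing
open CommSemigroupProps S.*-commutativeSemigroup using () renaming (interchange to ·-interchange)

module ∑ₛ = FiniteSum seriesRing

sumS≋∑ : ∀ n F → sumS n F ≋ ∑ₛ.∑ n F
sumS≋∑ zero    F a b c = P.refl
sumS≋∑ (suc n) F a b c = P.cong (Z._+ F n a b c) (sumS≋∑ n F a b c)

-- S.+-congˡ cannot recover its fixed summand from a goal, since _⊕_ unfolds
-- coefficientwise; these versions take it explicitly.
⊕-congˡ : ∀ f {g h} → g ≋ h → (f ⊕ g) ≋ (f ⊕ h)
⊕-congˡ f g≋h a b c = P.cong (λ t → f a b c Z.+ t) (g≋h a b c)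

⊖-congˡ : ∀ f {g h} → g ≋ h → (f ⊖ g) ≋ (f ⊖ h)
⊖-congˡ f g≋h = ⊕-congˡ f (S.-‿cong g≋h)

mono-cong : ∀ {s s′ a a′ b b′ c c′} → s ≡ s′ → a ≡ a′ → b ≡ b′ → c ≡ c′ → mono s a b c ≋ mono s′ a′ b′ c′
mono-cong P.refl P.refl P.refl P.refl _ _ _ = P.refl

mono-+ : ∀ s s′ a b c → mono (s Z.+ s′) a b c ≋ (mono s a b c ⊕ mono s′ a b c)
mono-+ s s′ a b c x y z with (x N.≡ᵇ a) ∧ (y N.≡ᵇ b) ∧ (z N.≡ᵇ c)
... | true  = P.refl
... | false = P.refl

⊝-mono : ∀ s a b c → (⊝ mono s a b c) ≋ mono (Z.- s) a b c
⊝-mono s a b c x y z with (x N.≡ᵇ a) ∧ (y N.≡ᵇ b) ∧ (z N.≡ᵇ c)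
... | true  = P.refl
... | false = P.refl

mono-zero : ∀ a b c → mono Z.0ℤ a b c ≋ zeroS
mono-zero a b c x y z with (x N.≡ᵇ a) ∧ (y N.≡ᵇ b) ∧ (z N.≡ᵇ c)
... | true  = P.refl
... | false = P.refl

mono≋δ : ∀ s a b c → mono s a b c ≋ PS₃.δ a (PS₂.δ b (PS₁.δ c s))
mono≋δ s a b c x y z with x N.≡ᵇ a
... | false = P.refl
... | true with y N.≡ᵇ b
... | false = P.refl
... | true with z N.≡ᵇ c
... | false = P.refl
... | true  = P.refl

mono-·-mono : ∀ s a b c s′ a′ b′ c′ →
  (mono s a b c · mono s′ a′ b′ c′) ≋ mono (s Z.* s′) (a N.+ a′) (b N.+ b′) (c N.+ c′)
mono-·-mono s a b c s′ a′ b′ c′ = begin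
  mono s a b c · mono s′ a′ b′ c′
    ≈⟨ ·-nested _ _ ⟩
  PS₃._*ₚ_ (mono s a b c) (mono s′ a′ b′ c′)
    ≈⟨ R₃.*-cong (mono≋δ s a b c) (mono≋δ s′ a′ b′ c′) ⟩
  PS₃._*ₚ_ (PS₃.δ a (PS₂.δ b (PS₁.δ c s))) (PS₃.δ a′ (PS₂.δ b′ (PS₁.δ c′ s′)))
    ≈⟨ PS₃.δ-*ₚ-δ a a′ _ _ ⟩
  PS₃.δ (a N.+ a′) (PS₂._*ₚ_ (PS₂.δ b (PS₁.δ c s)) (PS₂.δ b′ (PS₁.δ c′ s′)))
    ≈⟨ PS₃.δ-cong (a N.+ a′) (PS₂.δ-*ₚ-δ b b′ _ _) ⟩
  PS₃.δ (a N.+ a′) (PS₂.δ (b N.+ b′) (PS₁._*ₚ_ (PS₁.δ c s) (PS₁.δ c′ s′)))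
    ≈⟨ PS₃.δ-cong (a N.+ a′) (PS₂.δ-cong (b N.+ b′) (PS₁.δ-*ₚ-δ c c′ s s′)) ⟩
  PS₃.δ (a N.+ a′) (PS₂.δ (b N.+ b′) (PS₁.δ (c N.+ c′) (s Z.* s′)))
    ≈⟨ mono≋δ _ _ _ _ ⟨
  mono (s Z.* s′) (a N.+ a′) (b N.+ b′) (c N.+ c′) ∎
  where open SetoidReasoning R₃.setoid

module SeriesSolver where
  import Algebra.Solver.Ring.AlmostCommutativeRing as ACR
  open import Data.Maybe using (just; nothing)
  open import Relation.Binary.Definitions using (WeaklyDecidable)

  ℤ-coefficients : ACR._-Raw-AlmostCommutative⟶_ (CommutativeRing.rawRing ZP.+-*-commutativeRing)
                                                 (ACR.fromCommutativeRing seriesRing)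
  ℤ-coefficients = record
    { ⟦_⟧    = λ s → mono s 0 0 0
    ; +-homo = λ s s′ → mono-+ s s′ 0 0 0
    ; *-homo = λ s s′ → S.sym (mono-·-mono s 0 0 0 s′ 0 0 0)
    ; -‿homo = λ s → S.sym (⊝-mono s 0 0 0)
    ; 0-homo = mono-zero 0 0 0
    ; 1-homo = S.refl
    }

  ℤ-coefficients-≟ : WeaklyDecidable (ACR.Induced-equivalence ℤ-coefficients)
  ℤ-coefficients-≟ s s′ with s Z.≟ s′
  ... | yes s≡s′ = just (mono-cong s≡s′ P.refl P.refl P.refl)
  ... | no  _    = nothing

  open import Algebra.Solver.Ring _ _ ℤ-coefficients ℤ-coefficients-≟
    public using (solve; _:+_; _:*_; :-_; _:-_; _:=_; con)

open SeriesSolver using (solve; _:+_; _:*_; :-_; _:-_; _:=_; con)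

-- Agreement below a total degree
infix 4 _≈[_]_
_≈[_]_ : Series → ℕ → Series → Set
f ≈[ d ] g = ∀ a b c → a N.+ b N.+ c < d → f a b c ≡ g a b c

Ord≥ : ℕ → Series → Set
Ord≥ d f = f ≈[ d ] zeroS

≈[]-refl : ∀ {d f} → f ≈[ d ] f
≈[]-refl a b c _ = P.refl

≈[]-sym : ∀ {d f g} → f ≈[ d ] g → g ≈[ d ] f
≈[]-sym f≈g a b c lt = P.sym (f≈g a b c lt)

≈[]-trans : ∀ {d f g h} → f ≈[ d ] g → g ≈[ d ] h → f ≈[ d ] h
≈[]-trans f≈g g≈h a b c lt = P.trans (f≈g a b c lt) (g≈h a b c lt)

≈[]-setoid : ℕ → Setoid _ _
≈[]-setoid d = record
  { Carrier       = Series
  ; _≈_           = _≈[ d ]_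
  ; isEquivalence = record { refl = λ {f} → ≈[]-refl {d} {f} ; sym = ≈[]-sym ; trans = ≈[]-trans }
  }

≋⇒≈[] : ∀ {d f g} → f ≋ g → f ≈[ d ] g
≋⇒≈[] f≋g a b c _ = f≋g a b c

≈[]-weaken : ∀ {d d′ f g} → d ≤ d′ → f ≈[ d′ ] g → f ≈[ d ] g
≈[]-weaken d≤d′ f≈g a b c lt = f≈g a b c (NP.<-≤-trans lt d≤d′)

≈[]-⊕ : ∀ {d f f′ g g′} → f ≈[ d ] f′ → g ≈[ d ] g′ → (f ⊕ g) ≈[ d ] (f′ ⊕ g′)
≈[]-⊕ f≈f′ g≈g′ a b c lt = P.cong₂ Z._+_ (f≈f′ a b c lt) (g≈g′ a b c lt)

≈[]-∑ : ∀ {d} n {F G : ℕ → Series} → (∀ i → i < n → F i ≈[ d ] G i) → ∑ₛ.∑ n F ≈[ d ] ∑ₛ.∑ n G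
≈[]-∑ zero    F≈G = ≈[]-refl
≈[]-∑ (suc n) F≈G = ≈[]-⊕ (≈[]-∑ n (λ i i<n → F≈G i (NP.m<n⇒m<1+n i<n))) (F≈G n (NP.n<1+n n))

Ord≥-≋ : ∀ {d f g} → f ≋ g → Ord≥ d g → Ord≥ d f
Ord≥-≋ f≋g g≈0 a b c lt = P.trans (f≋g a b c) (g≈0 a b c lt)

Ord≥-weaken : ∀ {d d′ f} → d ≤ d′ → Ord≥ d′ f → Ord≥ d f
Ord≥-weaken = ≈[]-weaken

Ord≥-zero : ∀ f → Ord≥ 0 f
Ord≥-zero f a b c ()

Ord≥-sumS : ∀ {d} n {F : ℕ → Series} → (∀ i → i < n → Ord≥ d (F i)) → Ord≥ d (sumS n F)
Ord≥-sumS n F≈0 a b c lt = sumℤ-zero n (λ i i<n → F≈0 i i<n a b c lt)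

Ord≥-∑ : ∀ {d} n {F : ℕ → Series} → (∀ i → i < n → Ord≥ d (F i)) → Ord≥ d (∑ₛ.∑ n F)
Ord≥-∑ zero    F≈0 = ≈[]-refl
Ord≥-∑ (suc n) F≈0 = ≈[]-trans (≈[]-⊕ (Ord≥-∑ n (λ i i<n → F≈0 i (NP.m<n⇒m<1+n i<n))) (F≈0 n (NP.n<1+n n)))
                               (≋⇒≈[] (S.+-identityˡ zeroS))

Ord≥⇒≈[] : ∀ {d f g} → Ord≥ d (f ⊖ g) → f ≈[ d ] g
Ord≥⇒≈[] f-g≈0 a b c lt = ZP.i-j≡0⇒i≡j _ _ (f-g≈0 a b c lt)

≈[]⇒Ord≥ : ∀ {d f g} → f ≈[ d ] g → Ord≥ d (f ⊖ g)
≈[]⇒Ord≥ f≈g a b c lt = ZP.i≡j⇒i-j≡0 (f≈g a b c lt)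

⊖-Ord≥ : ∀ {d} f {h} → Ord≥ d h → (f ⊖ h) ≈[ d ] f
⊖-Ord≥ f h≈0 a b c lt = P.trans (P.cong (λ t → f a b c Z.+ Z.- t) (h≈0 a b c lt)) (ZP.+-identityʳ (f a b c))

∑-≈[]-extend : ∀ {d} n e (F : ℕ → Series) → (∀ i → i < e → Ord≥ d (F (n N.+ i))) → ∑ₛ.∑ n F ≈[ d ] ∑ₛ.∑ (n N.+ e) F
∑-≈[]-extend n e F tail≈0 = ≈[]-sym (≈[]-trans (≋⇒≈[] (∑ₛ.∑-split n e F))
  (≈[]-trans (≈[]-⊕ (≈[]-refl {f = ∑ₛ.∑ n F}) (Ord≥-∑ e tail≈0)) (≋⇒≈[] (S.+-identityʳ (∑ₛ.∑ n F)))))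

∑-≈[]-snoc : ∀ {d} n (F : ℕ → Series) → Ord≥ d (F n) → ∑ₛ.∑ n F ≈[ d ] ∑ₛ.∑ (suc n) F
∑-≈[]-snoc n F Fn≈0 = ≈[]-sym (≈[]-trans (≈[]-⊕ (≈[]-refl {f = ∑ₛ.∑ n F}) Fn≈0) (≋⇒≈[] (S.+-identityʳ (∑ₛ.∑ n F))))

Ord≥-mono : ∀ s a b c → Ord≥ (a N.+ b N.+ c) (mono s a b c)
Ord≥-mono s a b c x y z lt with x N.≡ᵇ a in x≡a | y N.≡ᵇ b in y≡b | z N.≡ᵇ c in z≡c
... | false | _     | _     = P.refl
... | true  | false | _     = P.refl
... | true  | true  | false = P.refl
... | true  | true  | true  =
  ⊥-elim (NP.<-irrefl (P.cong₂ N._+_ (P.cong₂ N._+_ (≡ᵇ⇒≡ {x} x≡a) (≡ᵇ⇒≡ {y} y≡b)) (≡ᵇ⇒≡ {z} z≡c)) lt)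
  where
  ≡ᵇ⇒≡ : ∀ {m n} → (m N.≡ᵇ n) ≡ true → m ≡ n
  ≡ᵇ⇒≡ {m} {n} eq = NP.≡ᵇ⇒≡ m n (P.subst T (P.sym eq) _)

private
  degree-split : ∀ {i a j b k c} → i ≤ a → j ≤ b → k ≤ c →
    (i N.+ j N.+ k) N.+ ((a ∸ i) N.+ (b ∸ j) N.+ (c ∸ k)) ≡ a N.+ b N.+ c
  degree-split {i} {a} {j} {b} {k} {c} i≤a j≤b k≤c =
    P.trans (regroup i j k (a ∸ i) (b ∸ j) (c ∸ k))
      (P.cong₂ N._+_ (P.cong₂ N._+_ (NP.m+[n∸m]≡n i≤a) (NP.m+[n∸m]≡n j≤b)) (NP.m+[n∸m]≡n k≤c))
    where
    regroup : ∀ i j k x y z → (i N.+ j N.+ k) N.+ (x N.+ y N.+ z) ≡ (i N.+ x) N.+ (j N.+ y) N.+ (k N.+ z)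
    regroup = ℕ-Solver.solve-∀

  ⊛-coeff-cong : ∀ f f′ g g′ a b c →
    (∀ i j k → i ≤ a → j ≤ b → k ≤ c →
      f i j k Z.* g (a ∸ i) (b ∸ j) (c ∸ k) ≡ f′ i j k Z.* g′ (a ∸ i) (b ∸ j) (c ∸ k)) →
    (f ⊛ g) a b c ≡ (f′ ⊛ g′) a b c
  ⊛-coeff-cong f f′ g g′ a b c terms≡ =
    sumℤ-cong< (suc a) (λ i i≤a → sumℤ-cong< (suc b) (λ j j≤b → sumℤ-cong< (suc c) (λ k k≤c →
      terms≡ i j k (NP.≤-pred i≤a) (NP.≤-pred j≤b) (NP.≤-pred k≤c))))

  ⊛-coeff-zero : ∀ f g a b c →
    (∀ i j k → i ≤ a → j ≤ b → k ≤ c → f i j k Z.* g (a ∸ i) (b ∸ j) (c ∸ k) ≡ Z.0ℤ) → (f ⊛ g) a b c ≡ Z.0ℤ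
  ⊛-coeff-zero f g a b c terms≡0 =
    sumℤ-zero (suc a) (λ i i≤a → sumℤ-zero (suc b) (λ j j≤b → sumℤ-zero (suc c) (λ k k≤c →
      terms≡0 i j k (NP.≤-pred i≤a) (NP.≤-pred j≤b) (NP.≤-pred k≤c))))

≈[]-· : ∀ {d f f′ g g′} → f ≈[ d ] f′ → g ≈[ d ] g′ → (f · g) ≈[ d ] (f′ · g′)
≈[]-· {d} {f} {f′} {g} {g′} f≈f′ g≈g′ = P.subst₂ _≈[ d ]_ (⊛≡· f g) (⊛≡· f′ g′) ⊛≈⊛
  where
  ⊛≈⊛ : (f ⊛ g) ≈[ d ] (f′ ⊛ g′)
  ⊛≈⊛ a b c lt = ⊛-coeff-cong f f′ g g′ a b c (λ i j k i≤a j≤b k≤c → P.cong₂ Z._*_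
    (f≈f′ i j k (NP.≤-<-trans (NP.m≤m+n (i N.+ j N.+ k) _) (P.subst (_< d) (P.sym (degree-split i≤a j≤b k≤c)) lt)))
    (g≈g′ _ _ _ (NP.≤-<-trans (NP.m≤n+m _ (i N.+ j N.+ k)) (P.subst (_< d) (P.sym (degree-split i≤a j≤b k≤c)) lt))))

Ord≥-· : ∀ d₁ d₂ {f g} → Ord≥ d₁ f → Ord≥ d₂ g → Ord≥ (d₁ N.+ d₂) (f · g)
Ord≥-· d₁ d₂ {f} {g} f≈0 g≈0 = P.subst (Ord≥ (d₁ N.+ d₂)) (⊛≡· f g) ⊛≈0
  where
  ⊛≈0 : Ord≥ (d₁ N.+ d₂) (f ⊛ g)
  ⊛≈0 a b c lt = ⊛-coeff-zero f g a b c term≡0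
    where
    term≡0 : ∀ i j k → i ≤ a → j ≤ b → k ≤ c → f i j k Z.* g (a ∸ i) (b ∸ j) (c ∸ k) ≡ Z.0ℤ
    term≡0 i j k i≤a j≤b k≤c with (i N.+ j N.+ k) N.<? d₁
    ... | yes low = P.trans (P.cong (Z._* g′) (f≈0 i j k low)) (ZP.*-zeroˡ g′)
      where g′ = g (a ∸ i) (b ∸ j) (c ∸ k)
    ... | no ¬low = P.trans (P.cong (f i j k Z.*_) (g≈0 _ _ _ high)) (ZP.*-zeroʳ (f i j k))
      where
      high : (a ∸ i) N.+ (b ∸ j) N.+ (c ∸ k) < d₂
      high = NP.+-cancelˡ-< d₁ _ d₂ (NP.≤-<-trans (NP.+-monoˡ-≤ _ (NP.≮⇒≥ ¬low))
               (P.subst (_< d₁ N.+ d₂) (P.sym (degree-split i≤a j≤b k≤c)) lt))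

Ord≥-·ˡ : ∀ d {f} g → Ord≥ d f → Ord≥ d (f · g)
Ord≥-·ˡ d g f≈0 = P.subst (λ e → Ord≥ e _) (NP.+-identityʳ d) (Ord≥-· d 0 f≈0 (Ord≥-zero g))

Ord≥-·ʳ : ∀ d f {g} → Ord≥ d g → Ord≥ d (f · g)
Ord≥-·ʳ d f g≈0 = Ord≥-· 0 d (Ord≥-zero f) g≈0

const : Series → ℤ
const f = f 0 0 0

const-· : ∀ f g → const (f · g) ≡ const f Z.* const g
const-· f g = P.subst (λ h → const h ≡ const f Z.* const g) (⊛≡· f g)
  (P.trans (ZP.+-identityˡ _) (P.trans (ZP.+-identityˡ _) (ZP.+-identityˡ _)))

const-·-1 : ∀ {f g} → const f ≡ Z.1ℤ → const g ≡ Z.1ℤ → const (f · g) ≡ Z.1ℤ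
const-·-1 {f} {g} f₀≡1 g₀≡1 = P.trans (const-· f g) (P.cong₂ Z._*_ f₀≡1 g₀≡1)

Ord≥-1⇒const≡0 : ∀ {f} → Ord≥ 1 f → const f ≡ Z.0ℤ
Ord≥-1⇒const≡0 f≈0 = f≈0 0 0 0 (s≤s z≤n)

const≡1⇒Ord≥-1 : ∀ {f} → const f ≡ Z.1ℤ → Ord≥ 1 (oneS ⊖ f)
const≡1⇒Ord≥-1 f₀≡1 zero zero zero _ rewrite f₀≡1 = P.refl
const≡1⇒Ord≥-1 f₀≡1 zero zero (suc c) (s≤s ())
const≡1⇒Ord≥-1 f₀≡1 zero (suc b) c (s≤s ())
const≡1⇒Ord≥-1 f₀≡1 (suc a) b c (s≤s ())

-- Inverses
infixr 8 _^_
_^_ : Series → ℕ → Series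
f ^ zero  = oneS
f ^ suc m = f ^ m · f

powS≋^ : ∀ f m → powS f m ≋ f ^ m
powS≋^ f zero    = S.refl
powS≋^ f (suc m) = S.trans (S.reflexive (⊛≡· (powS f m) f)) (S.*-cong (powS≋^ f m) S.refl)

Ord≥-^ : ∀ {g} → Ord≥ 1 g → ∀ m → Ord≥ m (g ^ m)
Ord≥-^ {g} g≈0 zero    = Ord≥-zero oneS
Ord≥-^ {g} g≈0 (suc m) = P.subst (λ e → Ord≥ e (g ^ suc m)) (NP.+-comm m 1) (Ord≥-· m 1 (Ord≥-^ g≈0 m) g≈0)

geometric-sum : ∀ g n → ((oneS ⊖ g) · ∑ₛ.∑ n (g ^_)) ≋ (oneS ⊖ g ^ n)
geometric-sum g zero    = S.trans (S.zeroʳ (oneS ⊖ g)) (S.sym (S.-‿inverseʳ oneS))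
geometric-sum g (suc n) = S.trans (S.distribˡ (oneS ⊖ g) _ _)
  (S.trans (S.+-congʳ (geometric-sum g n)) (telescope g (g ^ n)))
  where
  telescope : ∀ g h → ((oneS ⊖ h) ⊕ (oneS ⊖ g) · h) ≋ (oneS ⊖ h · g)
  telescope = solve 2 (λ g h → ((con Z.1ℤ :- h) :+ (con Z.1ℤ :- g) :* h) := (con Z.1ℤ :- h :* g)) S.refl

-- The powers (1 - f)^m with m > a + b + c, which the definition of invS omits,
-- have no terms in degree a + b + c.
invS-≈[]-geometric : ∀ {f} → const f ≡ Z.1ℤ → ∀ N → invS f ≈[ suc N ] ∑ₛ.∑ (suc N) ((oneS ⊖ f) ^_)
invS-≈[]-geometric {f} f₀≡1 N a b c lt = begin
  sumℤ (suc n) (λ m → powS g m a b c)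
    ≡⟨ sumℤ-extend (suc n) (N ∸ n) _ (λ m n<m → P.trans (powS≋^ g m a b c) (Ord≥-^ g≈0 m a b c n<m)) ⟨
  sumℤ (suc n N.+ (N ∸ n)) (λ m → powS g m a b c)
    ≡⟨ P.cong (λ e → sumℤ e (λ m → powS g m a b c)) (P.cong suc (NP.m+[n∸m]≡n (NP.≤-pred lt))) ⟩
  sumℤ (suc N) (λ m → powS g m a b c)
    ≡⟨ sumℤ-cong (suc N) (λ m → powS≋^ g m a b c) ⟩
  sumS (suc N) (g ^_) a b c
    ≡⟨ sumS≋∑ (suc N) (g ^_) a b c ⟩
  ∑ₛ.∑ (suc N) (g ^_) a b c ∎
  where
  open P.≡-Reasoning
  n = a N.+ b N.+ c
  g = oneS ⊖ f
  g≈0 = const≡1⇒Ord≥-1 f₀≡1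

invS-inverseʳ : ∀ {f} → const f ≡ Z.1ℤ → (f · invS f) ≋ oneS
invS-inverseʳ {f} f₀≡1 a b c = f·invS≈1 a b c (NP.n<1+n _)
  where
  N = a N.+ b N.+ c
  g = oneS ⊖ f
  open SetoidReasoning (≈[]-setoid (suc N))
  f·invS≈1 : (f · invS f) ≈[ suc N ] oneS
  f·invS≈1 = begin
    f · invS f                        ≈⟨ ≈[]-· ≈[]-refl (invS-≈[]-geometric f₀≡1 N) ⟩
    f · ∑ₛ.∑ (suc N) (g ^_)           ≈⟨ ≋⇒≈[] (S.*-congʳ (1-[1-f] f)) ⟨
    (oneS ⊖ g) · ∑ₛ.∑ (suc N) (g ^_)  ≈⟨ ≋⇒≈[] (geometric-sum g (suc N)) ⟩
    oneS ⊖ g ^ suc N                  ≈⟨ ⊖-Ord≥ oneS (Ord≥-^ (const≡1⇒Ord≥-1 f₀≡1) (suc N)) ⟩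
    oneS                              ∎
    where
    1-[1-f] : ∀ f → (oneS ⊖ (oneS ⊖ f)) ≋ f
    1-[1-f] = solve 1 (λ f → (con Z.1ℤ :- (con Z.1ℤ :- f)) := f) S.refl

invS-inverseˡ : ∀ {f} → const f ≡ Z.1ℤ → (invS f · f) ≋ oneS
invS-inverseˡ {f} f₀≡1 = S.trans (S.*-comm (invS f) f) (invS-inverseʳ f₀≡1)

·-cancelˡ : ∀ {f g h} → const f ≡ Z.1ℤ → (f · g) ≋ (f · h) → g ≋ h
·-cancelˡ {f} {g} {h} f₀≡1 fg≋fh = begin
  g                    ≈⟨ S.*-identityˡ g ⟨
  oneS · g             ≈⟨ S.*-congʳ (invS-inverseˡ f₀≡1) ⟨
  (invS f · f) · g     ≈⟨ S.*-assoc _ _ _ ⟩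
  invS f · (f · g)     ≈⟨ S.*-congˡ fg≋fh ⟩
  invS f · (f · h)     ≈⟨ S.*-assoc _ _ _ ⟨
  (invS f · f) · h     ≈⟨ S.*-congʳ (invS-inverseˡ f₀≡1) ⟩
  oneS · h             ≈⟨ S.*-identityˡ h ⟩
  h                    ∎
  where open SetoidReasoning S.setoid

invS-unique : ∀ {f h} → const f ≡ Z.1ℤ → (f · h) ≋ oneS → h ≋ invS f
invS-unique f₀≡1 fh≋1 = ·-cancelˡ f₀≡1 (S.trans fh≋1 (S.sym (invS-inverseʳ f₀≡1)))

invS-cong : ∀ {f g} → const f ≡ Z.1ℤ → f ≋ g → invS f ≋ invS g
invS-cong {f} {g} f₀≡1 f≋g = invS-unique (P.trans (P.sym (f≋g 0 0 0)) f₀≡1)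
  (S.trans (S.*-congʳ (S.sym f≋g)) (invS-inverseʳ f₀≡1))

invS-· : ∀ {f g} → const f ≡ Z.1ℤ → const g ≡ Z.1ℤ → invS (f · g) ≋ (invS f · invS g)
invS-· {f} {g} f₀≡1 g₀≡1 = S.sym (invS-unique (const-·-1 f₀≡1 g₀≡1)
  (S.trans (·-interchange f g (invS f) (invS g))
  (S.trans (S.*-cong (invS-inverseʳ f₀≡1) (invS-inverseʳ g₀≡1)) (S.*-identityˡ oneS))))

invS-oneS : invS oneS ≋ oneS
invS-oneS = S.sym (invS-unique P.refl (S.*-identityˡ oneS))

choose2-suc : ∀ m → choose2 (suc m) ≡ choose2 m N.+ m
choose2-suc m = begin
  suc m N.* m N./ 2                       ≡⟨ P.cong (N._/ 2) (double m) ⟩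
  (m N.* (m ∸ 1) N.+ m N.* 2) N./ 2       ≡⟨ +-distrib-/-∣ʳ (m N.* (m ∸ 1)) (n∣m*n m) ⟩
  choose2 m N.+ m N.* 2 N./ 2             ≡⟨ P.cong (choose2 m N.+_) (m*n/n≡m m 2) ⟩
  choose2 m N.+ m                         ∎
  where
  open P.≡-Reasoning
  double : ∀ m → suc m N.* m ≡ m N.* (m ∸ 1) N.+ m N.* 2
  double zero    = P.refl
  double (suc k) = expand k
    where
    expand : ∀ k → suc (suc k) N.* suc k ≡ suc k N.* k N.+ suc k N.* 2
    expand = ℕ-Solver.solve-∀

choose2-+ : ∀ a c → choose2 (a N.+ c) ≡ choose2 a N.+ choose2 c N.+ a N.* c
choose2-+ a zero rewrite NP.+-identityʳ a | NP.*-zeroʳ a = P.sym (P.trans (NP.+-identityʳ _) (NP.+-identityʳ _))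
choose2-+ a (suc c) rewrite NP.+-suc a c | choose2-suc (a N.+ c) | choose2-+ a c | choose2-suc c =
  rearrange (choose2 a) (choose2 c) a c
  where
  rearrange : ∀ x y a c → x N.+ y N.+ a N.* c N.+ (a N.+ c) ≡ x N.+ (y N.+ c) N.+ a N.* suc c
  rearrange = ℕ-Solver.solve-∀

choose2-double : ∀ a → choose2 a N.+ choose2 a N.+ a ≡ a N.* a
choose2-double zero    = P.refl
choose2-double (suc a) rewrite choose2-suc a = begin
  choose2 a N.+ a N.+ (choose2 a N.+ a) N.+ suc a   ≡⟨ rearrange (choose2 a) a ⟩
  (choose2 a N.+ choose2 a N.+ a) N.+ a N.+ suc a   ≡⟨ P.cong (λ x → x N.+ a N.+ suc a) (choose2-double a) ⟩
  a N.* a N.+ a N.+ suc a                           ≡⟨ square-suc a ⟩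
  suc a N.* suc a                                   ∎
  where
  open P.≡-Reasoning
  rearrange : ∀ x a → x N.+ a N.+ (x N.+ a) N.+ suc a ≡ (x N.+ x N.+ a) N.+ a N.+ suc a
  rearrange = ℕ-Solver.solve-∀
  square-suc : ∀ a → a N.* a N.+ a N.+ suc a ≡ suc a N.* suc a
  square-suc = ℕ-Solver.solve-∀

signℤ-+ : ∀ m n → signℤ (m N.+ n) ≡ signℤ m Z.* signℤ n
signℤ-+ zero    n = P.sym (ZP.*-identityˡ _)
signℤ-+ (suc m) n = P.trans (P.cong Z.-_ (signℤ-+ m n)) (ZP.neg-distribˡ-* (signℤ m) (signℤ n))

signℤ-double : ∀ m → signℤ (m N.+ m) ≡ Z.1ℤ
signℤ-double zero    = P.refl
signℤ-double (suc m) rewrite NP.+-suc m m = P.trans (ZP.neg-involutive _) (signℤ-double m)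

-1^≡signℤ : ∀ k → Z.-1ℤ Z.^ k ≡ signℤ k
-1^≡signℤ zero    = P.refl
-1^≡signℤ (suc k) = P.trans (ZP.-1*i≡-i (Z.-1ℤ Z.^ k)) (P.cong Z.-_ (-1^≡signℤ k))

mono-^ : ∀ s a b c k → mono s a b c ^ k ≋ mono (s Z.^ k) (k N.* a) (k N.* b) (k N.* c)
mono-^ s a b c zero    = S.refl
mono-^ s a b c (suc k) = S.trans (S.*-congʳ (mono-^ s a b c k))
  (S.trans (mono-·-mono _ _ _ _ s a b c)
    (mono-cong (ZP.*-comm _ s) (NP.+-comm (k N.* a) a) (NP.+-comm (k N.* b) b) (NP.+-comm (k N.* c) c)))

^-distrib-· : ∀ f g k → (f · g) ^ k ≋ (f ^ k · g ^ k)
^-distrib-· f g zero    = S.sym (S.*-identityˡ oneS)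
^-distrib-· f g (suc k) = S.trans (S.*-congʳ (^-distrib-· f g k)) (·-interchange (f ^ k) (g ^ k) f g)

-- q-Pochhammer symbols and q-binomial coefficients
q^_ : ℕ → Series
q^ e = mono Z.1ℤ e 0 0

q^-+ : ∀ a b → (q^ a · q^ b) ≋ q^ (a N.+ b)
q^-+ a b = mono-·-mono Z.1ℤ a 0 0 Z.1ℤ b 0 0

Ord≥-q^ : ∀ e → Ord≥ e (q^ e)
Ord≥-q^ e = P.subst (λ d → Ord≥ d (q^ e)) (P.trans (NP.+-identityʳ _) (NP.+-identityʳ e)) (Ord≥-mono Z.1ℤ e 0 0)

Ord≥-1-q^-suc : ∀ e → Ord≥ 1 (q^ suc e)
Ord≥-1-q^-suc e = Ord≥-weaken (s≤s z≤n) (Ord≥-q^ (suc e))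

qPoch : Series → ℕ → Series
qPoch z zero    = oneS
qPoch z (suc n) = qPoch z n · (oneS ⊖ z · q^ n)

poch≋qPoch : ∀ z n → poch z n ≋ qPoch z n
poch≋qPoch z zero    = S.refl
poch≋qPoch z (suc n) = S.trans (S.reflexive (⊛≡· (poch z n) (oneS ⊖ z ⊛ q^ n)))
  (S.*-cong (poch≋qPoch z n) (⊖-congˡ oneS (S.reflexive (⊛≡· z (q^ n)))))

⊛≋· : ∀ {f f′ g g′} → f ≋ f′ → g ≋ g′ → (f ⊛ g) ≋ (f′ · g′)
⊛≋· {f} {f′} {g} {g′} f≋f′ g≋g′ = S.trans (S.reflexive (⊛≡· f g)) (S.*-cong f≋f′ g≋g′)

qPoch-cong : ∀ {z z′} n → z ≋ z′ → qPoch z n ≋ qPoch z′ n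
qPoch-cong zero    z≋z′ = S.refl
qPoch-cong (suc n) z≋z′ = S.*-cong (qPoch-cong n z≋z′) (⊖-congˡ oneS (S.*-congʳ z≋z′))

qPoch-+ : ∀ z m k → qPoch z (m N.+ k) ≋ (qPoch z m · qPoch (z · q^ m) k)
qPoch-+ z m zero    = S.trans (S.reflexive (P.cong (qPoch z) (NP.+-identityʳ m))) (S.sym (S.*-identityʳ _))
qPoch-+ z m (suc k) = S.trans (S.reflexive (P.cong (qPoch z) (NP.+-suc m k)))
  (S.trans (S.*-cong (qPoch-+ z m k) (⊖-congˡ oneS shift))
  (S.*-assoc _ _ _))
  where
  shift : (z · q^ (m N.+ k)) ≋ ((z · q^ m) · q^ k)
  shift = S.sym (S.trans (S.*-assoc z (q^ m) (q^ k)) (S.*-congˡ (q^-+ m k)))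

qPoch-unconsˡ : ∀ y k → qPoch y (suc k) ≋ ((oneS ⊖ y) · qPoch (y · q^ 1) k)
qPoch-unconsˡ y k = S.trans (qPoch-+ y 1 k)
  (S.*-congʳ (S.trans (S.*-identityˡ (oneS ⊖ y · q^ 0)) (⊖-congˡ oneS (S.*-identityʳ y))))

qPoch-≈[]-1 : ∀ {d z} → Ord≥ d z → ∀ k → qPoch z k ≈[ d ] oneS
qPoch-≈[]-1 z≈0 zero    = ≈[]-refl
qPoch-≈[]-1 {d} {z} z≈0 (suc k) =
  ≈[]-trans (≈[]-· (qPoch-≈[]-1 z≈0 k) (⊖-Ord≥ oneS (Ord≥-·ˡ d (q^ k) z≈0))) (≋⇒≈[] (S.*-identityˡ oneS))

const-qPoch : ∀ {z} → Ord≥ 1 z → ∀ n → const (qPoch z n) ≡ Z.1ℤ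
const-qPoch z≈0 n = qPoch-≈[]-1 z≈0 n 0 0 0 (s≤s z≤n)

const-poch : ∀ {z} → Ord≥ 1 z → ∀ n → const (poch z n) ≡ Z.1ℤ
const-poch z≈0 n = P.trans (poch≋qPoch _ n 0 0 0) (const-qPoch z≈0 n)

invS-poch : ∀ {z} → Ord≥ 1 z → ∀ n → invS (poch z n) ≋ invS (qPoch z n)
invS-poch z≈0 n = invS-cong (const-poch z≈0 n) (poch≋qPoch _ n)

const-1-⊖ : ∀ {y} → Ord≥ 1 y → const (oneS ⊖ y) ≡ Z.1ℤ
const-1-⊖ {y} y≈0 = P.cong (λ t → Z.1ℤ Z.+ Z.- t) (Ord≥-1⇒const≡0 y≈0)

Ord≥-1-·q : ∀ y → Ord≥ 1 (y · q^ 1)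
Ord≥-1-·q y = Ord≥-·ʳ 1 y (Ord≥-1-q^-suc 0)

qFac : ℕ → Series
qFac = qPoch (q^ 1)

qFac⁻¹ : ℕ → Series
qFac⁻¹ n = invS (qFac n)

const-qFac : ∀ n → const (qFac n) ≡ Z.1ℤ
const-qFac = const-qPoch (Ord≥-1-q^-suc 0)

qBinomial : ℕ → ℕ → Series
qBinomial n       zero    = oneS
qBinomial zero    (suc k) = zeroS
qBinomial (suc n) (suc k) = qBinomial n (suc k) ⊕ q^ (n ∸ k) · qBinomial n k

qBinomial-over : ∀ n k → n < k → qBinomial n k ≋ zeroS
qBinomial-over zero    (suc k) _         = S.refl
qBinomial-over (suc n) (suc k) (s≤s n<k) = S.trans
  (S.+-cong (qBinomial-over n (suc k) (NP.m<n⇒m<1+n n<k))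
            (S.trans (S.*-congˡ (qBinomial-over n k n<k)) (S.zeroʳ _)))
  (S.+-identityˡ zeroS)

rotheCoeff : ℕ → Series
rotheCoeff c = mono (signℤ c) (choose2 c) 0 0

rotheCoeff-suc : ∀ c n → c ≤ n → (rotheCoeff (suc c) · q^ (n ∸ c)) ≋ (⊝ (rotheCoeff c · q^ n))
rotheCoeff-suc c n c≤n = begin
  rotheCoeff (suc c) · q^ (n ∸ c)
    ≈⟨ mono-·-mono _ _ 0 0 Z.1ℤ (n ∸ c) 0 0 ⟩
  mono (signℤ (suc c) Z.* Z.1ℤ) (choose2 (suc c) N.+ (n ∸ c)) 0 0
    ≈⟨ mono-cong (ZP.*-identityʳ _) exponent P.refl P.refl ⟩
  mono (Z.- signℤ c) (choose2 c N.+ n) 0 0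
    ≈⟨ ⊝-mono (signℤ c) (choose2 c N.+ n) 0 0 ⟨
  ⊝ mono (signℤ c) (choose2 c N.+ n) 0 0
    ≈⟨ S.-‿cong (S.trans (mono-·-mono _ _ 0 0 Z.1ℤ n 0 0) (mono-cong (ZP.*-identityʳ _) P.refl P.refl P.refl)) ⟨
  ⊝ (rotheCoeff c · q^ n) ∎
  where
  open SetoidReasoning S.setoid
  exponent : choose2 (suc c) N.+ (n ∸ c) ≡ choose2 c N.+ n
  exponent = P.trans (P.cong (N._+ (n ∸ c)) (choose2-suc c))
    (P.trans (NP.+-assoc (choose2 c) c (n ∸ c)) (P.cong (choose2 c N.+_) (NP.m+[n∸m]≡n c≤n)))

rotheTerm : ℕ → Series → ℕ → Series
rotheTerm n z c = rotheCoeff c · qBinomial n c · z ^ c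

rotheTerm-suc : ∀ n z c → c ≤ n →
  rotheTerm (suc n) z (suc c) ≋ (rotheTerm n z (suc c) ⊖ rotheTerm n z c · (z · q^ n))
rotheTerm-suc n z c c≤n = begin
  s′ · (b′ ⊕ q^ (n ∸ c) · b) · (z ^ c · z)
    ≈⟨ expand s′ b′ (q^ (n ∸ c)) b (z ^ c) z ⟩
  rotheTerm n z (suc c) ⊕ (s′ · q^ (n ∸ c)) · (b · z ^ c · z)
    ≈⟨ ⊕-congˡ (rotheTerm n z (suc c)) (S.*-congʳ (rotheCoeff-suc c n c≤n)) ⟩
  rotheTerm n z (suc c) ⊕ ⊝ (s · q^ n) · (b · z ^ c · z)
    ≈⟨ ⊕-congˡ (rotheTerm n z (suc c)) (regroup s (q^ n) b (z ^ c) z) ⟩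
  rotheTerm n z (suc c) ⊖ rotheTerm n z c · (z · q^ n) ∎
  where
  open SetoidReasoning S.setoid
  s = rotheCoeff c
  s′ = rotheCoeff (suc c)
  b = qBinomial n c
  b′ = qBinomial n (suc c)
  expand : ∀ s′ b′ r b w z → (s′ · (b′ ⊕ r · b) · (w · z)) ≋ (s′ · b′ · (w · z) ⊕ (s′ · r) · (b · w · z))
  expand = solve 6 (λ s′ b′ r b w z →
    (s′ :* (b′ :+ r :* b) :* (w :* z)) := (s′ :* b′ :* (w :* z) :+ (s′ :* r) :* (b :* w :* z))) S.refl
  regroup : ∀ s r b w z → ((⊝ (s · r)) · (b · w · z)) ≋ (⊝ (s · b · w · (z · r)))
  regroup = solve 5 (λ s r b w z → ((:- (s :* r)) :* (b :* w :* z)) := (:- (s :* b :* w :* (z :* r)))) S.refl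

rothe : ∀ n z → qPoch z n ≋ ∑ₛ.∑ (suc n) (rotheTerm n z)
rothe zero    z = S.sym (S.trans (S.+-identityˡ _) (S.trans (S.*-identityʳ _) (S.*-identityʳ oneS)))
rothe (suc n) z = S.sym (begin
  ∑ (suc (suc n)) (rotheTerm (suc n) z)
    ≈⟨ ∑ₛ.∑-recurrence n (rotheTerm n z) (rotheTerm (suc n) z) (λ c → ⊝ (rotheTerm n z c · X))
         S.refl (λ c c≤n → rotheTerm-suc n z c c≤n) top-term-vanishes ⟩
  ∑ (suc n) (rotheTerm n z) ⊕ ∑ (suc n) (λ c → ⊝ (rotheTerm n z c · X))
    ≈⟨ ⊕-congˡ (∑ (suc n) (rotheTerm n z)) (S.trans (∑ₛ.∑-neg (suc n) (λ c → rotheTerm n z c · X))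
                                                    (S.-‿cong (S.sym (∑ₛ.∑-*ʳ (suc n) X (rotheTerm n z))))) ⟩
  ∑ (suc n) (rotheTerm n z) ⊖ ∑ (suc n) (rotheTerm n z) · X
    ≈⟨ factor (∑ (suc n) (rotheTerm n z)) X ⟩
  ∑ (suc n) (rotheTerm n z) · (oneS ⊖ X)
    ≈⟨ S.*-congʳ (rothe n z) ⟨
  qPoch z n · (oneS ⊖ X) ∎)
  where
  open SetoidReasoning S.setoid
  ∑ = ∑ₛ.∑
  X = z · q^ n
  top-term-vanishes : rotheTerm n z (suc n) ≋ zeroS
  top-term-vanishes = S.trans (S.*-congʳ (S.trans (S.*-congˡ (qBinomial-over n (suc n) (NP.n<1+n n))) (S.zeroʳ _))) (S.zeroˡ _)
  factor : ∀ p x → (p ⊖ p · x) ≋ (p · (oneS ⊖ x))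
  factor = solve 2 (λ p x → (p :- p :* x) := (p :* (con Z.1ℤ :- x))) S.refl

qBinomial-factorial-shift : ∀ j c → c ≤ j →
  (c < j → (qFac (suc c) · qFac (j ∸ suc c) · qBinomial j (suc c)) ≋ qFac j) →
  (qFac (suc c) · qFac (j ∸ c) · qBinomial j (suc c)) ≋ (qFac j · (oneS ⊖ q^ (j ∸ c)))
qBinomial-factorial-shift j c c≤j factorial with NP.m≤n⇒m<n∨m≡n c≤j
... | inj₂ P.refl = begin
  qFac (suc c) · qFac (c ∸ c) · qBinomial c (suc c)   ≈⟨ S.*-congˡ (qBinomial-over c (suc c) (NP.n<1+n c)) ⟩
  qFac (suc c) · qFac (c ∸ c) · zeroS                 ≈⟨ S.zeroʳ _ ⟩
  zeroS                                               ≈⟨ S.zeroʳ (qFac c) ⟨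
  qFac c · zeroS                                      ≈⟨ S.*-congˡ 1-q⁰≋0 ⟨
  qFac c · (oneS ⊖ q^ (c ∸ c))                        ∎
  where
  open SetoidReasoning S.setoid
  1-q⁰≋0 : (oneS ⊖ q^ (c ∸ c)) ≋ zeroS
  1-q⁰≋0 = S.trans (⊖-congˡ oneS (S.reflexive (P.cong q^_ (NP.n∸n≡0 c)))) (S.-‿inverseʳ oneS)
... | inj₁ c<j = begin
  qFac (suc c) · qFac (j ∸ c) · qBinomial j (suc c)
    ≡⟨ P.cong (λ e → qFac (suc c) · qFac e · qBinomial j (suc c)) j∸c≡1+m ⟩
  qFac (suc c) · (qFac m · (oneS ⊖ q^ 1 · q^ m)) · qBinomial j (suc c)
    ≈⟨ pull-out (qFac (suc c)) (qFac m) (oneS ⊖ q^ 1 · q^ m) (qBinomial j (suc c)) ⟩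
  (qFac (suc c) · qFac m · qBinomial j (suc c)) · (oneS ⊖ q^ 1 · q^ m)
    ≈⟨ S.*-cong (factorial c<j) (⊖-congˡ oneS (q^-+ 1 m)) ⟩
  qFac j · (oneS ⊖ q^ suc m)
    ≡⟨ P.cong (λ e → qFac j · (oneS ⊖ q^ e)) j∸c≡1+m ⟨
  qFac j · (oneS ⊖ q^ (j ∸ c)) ∎
  where
  open SetoidReasoning S.setoid
  m = j ∸ suc c
  j∸c≡1+m : j ∸ c ≡ suc m
  j∸c≡1+m = NP.+-∸-assoc 1 c<j
  pull-out : ∀ a f g b → (a · (f · g) · b) ≋ ((a · f · b) · g)
  pull-out = solve 4 (λ a f g b → (a :* (f :* g) :* b) := ((a :* f :* b) :* g)) S.refl

qBinomial-factorial : ∀ j c → c ≤ j → (qFac c · qFac (j ∸ c) · qBinomial j c) ≋ qFac j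
qBinomial-factorial j       zero    _         = S.trans (S.*-identityʳ (oneS · qFac j)) (S.*-identityˡ (qFac j))
qBinomial-factorial (suc j) (suc c) (s≤s c≤j) = begin
  qFac (suc c) · qFac (j ∸ c) · (qBinomial j (suc c) ⊕ q^ (j ∸ c) · qBinomial j c)
    ≈⟨ expand (qFac c) (oneS ⊖ q^ 1 · q^ c) (qFac (j ∸ c)) (qBinomial j (suc c)) (q^ (j ∸ c)) (qBinomial j c) ⟩
  qFac (suc c) · qFac (j ∸ c) · qBinomial j (suc c)
    ⊕ (qFac c · qFac (j ∸ c) · qBinomial j c) · ((oneS ⊖ q^ 1 · q^ c) · q^ (j ∸ c))
    ≈⟨ S.+-cong (qBinomial-factorial-shift j c c≤j (qBinomial-factorial j (suc c)))
                (S.*-congʳ (qBinomial-factorial j c c≤j)) ⟩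
  qFac j · (oneS ⊖ q^ (j ∸ c)) ⊕ qFac j · ((oneS ⊖ q^ 1 · q^ c) · q^ (j ∸ c))
    ≈⟨ collect (qFac j) (q^ (j ∸ c)) (q^ 1 · q^ c) ⟩
  qFac j · (oneS ⊖ (q^ 1 · q^ c) · q^ (j ∸ c))
    ≈⟨ S.*-congˡ (⊖-congˡ oneS exponent) ⟩
  qFac (suc j) ∎
  where
  open SetoidReasoning S.setoid
  expand : ∀ p f r b′ x b → (p · f · r · (b′ ⊕ x · b)) ≋ (p · f · r · b′ ⊕ (p · r · b) · (f · x))
  expand = solve 6 (λ p f r b′ x b →
    (p :* f :* r :* (b′ :+ x :* b)) := (p :* f :* r :* b′ :+ (p :* r :* b) :* (f :* x))) S.refl
  collect : ∀ p x y → (p · (oneS ⊖ x) ⊕ p · ((oneS ⊖ y) · x)) ≋ (p · (oneS ⊖ y · x))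
  collect = solve 3 (λ p x y →
    (p :* (con Z.1ℤ :- x) :+ p :* ((con Z.1ℤ :- y) :* x)) := (p :* (con Z.1ℤ :- y :* x))) S.refl
  exponent : ((q^ 1 · q^ c) · q^ (j ∸ c)) ≋ (q^ 1 · q^ j)
  exponent = S.trans (S.*-assoc (q^ 1) (q^ c) (q^ (j ∸ c)))
    (S.*-congˡ (S.trans (q^-+ c (j ∸ c)) (S.reflexive (P.cong q^_ (NP.m+[n∸m]≡n c≤j)))))

qBinomial-top : ∀ M j → j ≤ M → (qFac j · qBinomial M j) ≋ qPoch (q^ 1 · q^ (M ∸ j)) j
qBinomial-top M j j≤M = ·-cancelˡ (const-qFac (M ∸ j)) (begin
  qFac (M ∸ j) · (qFac j · qBinomial M j)     ≈⟨ S.*-assoc (qFac (M ∸ j)) (qFac j) (qBinomial M j) ⟨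
  qFac (M ∸ j) · qFac j · qBinomial M j       ≈⟨ S.*-congʳ (S.*-comm (qFac (M ∸ j)) (qFac j)) ⟩
  qFac j · qFac (M ∸ j) · qBinomial M j       ≈⟨ qBinomial-factorial M j j≤M ⟩
  qFac M                                      ≡⟨ P.cong qFac (NP.m∸n+n≡m j≤M) ⟨
  qFac ((M ∸ j) N.+ j)                        ≈⟨ qPoch-+ (q^ 1) (M ∸ j) j ⟩
  qFac (M ∸ j) · qPoch (q^ 1 · q^ (M ∸ j)) j  ∎)
  where open SetoidReasoning S.setoid

-- (q;q)_j [M, j] = (q^{M-j+1};q)_j differs from 1 only from degree M - j + 1 on,
-- and the factor m supplies j more degrees.
qBinomial-≈[]-qFac⁻¹ : ∀ M j → j ≤ M → ∀ m → Ord≥ j m → (qBinomial M j · m) ≈[ suc M ] (qFac⁻¹ j · m)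
qBinomial-≈[]-qFac⁻¹ M j j≤M m m≈0 = Ord≥⇒≈[] (λ a b c lt →
  P.trans (difference a b c) (Ord≥-· (suc (M ∸ j)) j (Ord≥-·ʳ (suc (M ∸ j)) (qFac⁻¹ j) D≈0) m≈0 a b c
    (P.subst (a N.+ b N.+ c <_) (P.cong suc (P.sym (NP.m∸n+n≡m j≤M))) lt)))
  where
  B = qBinomial M j
  I = qFac⁻¹ j
  D = qFac j · B ⊖ oneS
  D≈0 : Ord≥ (suc (M ∸ j)) D
  D≈0 = ≈[]⇒Ord≥ (≈[]-trans (≋⇒≈[] (qBinomial-top M j j≤M))
          (qPoch-≈[]-1 (Ord≥-· 1 (M ∸ j) (Ord≥-q^ 1) (Ord≥-q^ (M ∸ j))) j))
  difference : (B · m ⊖ I · m) ≋ (I · D · m)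
  difference = S.sym (begin
    I · D · m                 ≈⟨ expand I (qFac j) B m ⟩
    (I · qFac j) · B · m ⊖ I · m ≈⟨ S.+-congʳ (S.*-congʳ (S.*-congʳ (invS-inverseˡ (const-qFac j)))) ⟩
    oneS · B · m ⊖ I · m     ≈⟨ S.+-congʳ (S.*-congʳ (S.*-identityˡ B)) ⟩
    B · m ⊖ I · m            ∎)
    where
    open SetoidReasoning S.setoid
    expand : ∀ i f b m → (i · (f · b ⊖ oneS) · m) ≋ ((i · f) · b · m ⊖ i · m)
    expand = solve 4 (λ i f b m → (i :* (f :* b :- con Z.1ℤ) :* m) := ((i :* f) :* b :* m :- i :* m)) S.refl

qFac⁻¹-· : ∀ j c → c ≤ j → (qFac⁻¹ c · qFac⁻¹ (j ∸ c)) ≋ (qBinomial j c · qFac⁻¹ j)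
qFac⁻¹-· j c c≤j = S.trans (S.sym (invS-· (const-qFac c) (const-qFac (j ∸ c))))
  (S.sym (invS-unique (const-·-1 (const-qFac c) (const-qFac (j ∸ c)))
    (S.trans (S.sym (S.*-assoc (qFac c · qFac (j ∸ c)) (qBinomial j c) (qFac⁻¹ j)))
      (S.trans (S.*-congʳ (qBinomial-factorial j c c≤j)) (invS-inverseʳ (const-qFac j))))))

-- A finite Durfee identity
twoChoose2 : ℕ → ℕ
twoChoose2 k = choose2 k N.+ choose2 k

-- qPoch-·-durfeeSum is a finite form of 1/(y;q)_∞ = Σ_k q^{k(k-1)} y^k / ((q;q)_k (y;q)_k).
durfeeTerm : ℕ → Series → ℕ → Series
durfeeTerm N y k = qBinomial N k · q^ twoChoose2 k · y ^ k · invS (qPoch y k)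

durfeeSum : ℕ → Series → Series
durfeeSum N y = ∑ₛ.∑ (suc N) (durfeeTerm N y)

durfeeTerm-suc : ∀ N y → Ord≥ 1 y → ∀ k → k ≤ N →
  durfeeTerm (suc N) y (suc k) ≋ (durfeeTerm N y (suc k) ⊕ (y · q^ N · invS (oneS ⊖ y)) · durfeeTerm N (y · q^ 1) k)
durfeeTerm-suc N y y≈0 k k≤N = begin
  (B′ ⊕ q^ (N ∸ k) · B) · q^ twoChoose2 (suc k) · (y ^ k · y) · invS (qPoch y (suc k))
    ≈⟨ expand B′ (q^ (N ∸ k)) B (q^ twoChoose2 (suc k)) (y ^ k) y (invS (qPoch y (suc k))) ⟩
  durfeeTerm N y (suc k) ⊕ (q^ (N ∸ k) · q^ twoChoose2 (suc k)) · (B · y ^ k · y · invS (qPoch y (suc k)))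
    ≈⟨ ⊕-congˡ (durfeeTerm N y (suc k)) (S.*-cong exponent (S.*-congˡ invS-qPoch-suc)) ⟩
  durfeeTerm N y (suc k) ⊕ (q^ N · (q^ twoChoose2 k · q^ k)) · (B · y ^ k · y · (I₁ · invS (qPoch yq k)))
    ≈⟨ ⊕-congˡ (durfeeTerm N y (suc k)) (regroup (q^ N) (q^ twoChoose2 k) (q^ k) B (y ^ k) y I₁ (invS (qPoch yq k))) ⟩
  durfeeTerm N y (suc k) ⊕ (y · q^ N · I₁) · (B · q^ twoChoose2 k · (y ^ k · q^ k) · invS (qPoch yq k))
    ≈⟨ ⊕-congˡ (durfeeTerm N y (suc k)) (S.*-congˡ (S.*-congʳ (S.*-congˡ (S.sym yq^k)))) ⟩
  durfeeTerm N y (suc k) ⊕ (y · q^ N · invS (oneS ⊖ y)) · durfeeTerm N yq k ∎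
  where
  open SetoidReasoning S.setoid
  B = qBinomial N k
  B′ = qBinomial N (suc k)
  yq = y · q^ 1
  I₁ = invS (oneS ⊖ y)
  expand : ∀ b′ r b e w y i → ((b′ ⊕ r · b) · e · (w · y) · i) ≋ (b′ · e · (w · y) · i ⊕ (r · e) · (b · w · y · i))
  expand = solve 7 (λ b′ r b e w y i →
    ((b′ :+ r :* b) :* e :* (w :* y) :* i) := (b′ :* e :* (w :* y) :* i :+ (r :* e) :* (b :* w :* y :* i))) S.refl
  regroup : ∀ r e k b w y i j → ((r · (e · k)) · (b · w · y · (i · j))) ≋ ((y · r · i) · (b · e · (w · k) · j))
  regroup = solve 8 (λ r e k b w y i j →
    ((r :* (e :* k)) :* (b :* w :* y :* (i :* j))) := ((y :* r :* i) :* (b :* e :* (w :* k) :* j))) S.refl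
  exponent : (q^ (N ∸ k) · q^ twoChoose2 (suc k)) ≋ (q^ N · (q^ twoChoose2 k · q^ k))
  exponent = S.trans (q^-+ (N ∸ k) (twoChoose2 (suc k))) (S.trans (S.reflexive (P.cong q^_ exponent-sum))
    (S.sym (S.trans (S.*-congˡ (q^-+ (twoChoose2 k) k)) (q^-+ N (twoChoose2 k N.+ k)))))
    where
    rearrange : ∀ d c k → d N.+ ((c N.+ k) N.+ (c N.+ k)) ≡ (k N.+ d) N.+ ((c N.+ c) N.+ k)
    rearrange = ℕ-Solver.solve-∀
    exponent-sum : (N ∸ k) N.+ twoChoose2 (suc k) ≡ N N.+ (twoChoose2 k N.+ k)
    exponent-sum rewrite choose2-suc k = P.trans (rearrange (N ∸ k) (choose2 k) k)
      (P.cong (N._+ (twoChoose2 k N.+ k)) (NP.m+[n∸m]≡n k≤N))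
  invS-qPoch-suc : invS (qPoch y (suc k)) ≋ (invS (oneS ⊖ y) · invS (qPoch yq k))
  invS-qPoch-suc = S.trans (invS-cong (const-qPoch y≈0 (suc k)) (qPoch-unconsˡ y k))
    (invS-· (const-1-⊖ y≈0) (const-qPoch (Ord≥-1-·q y) k))
  yq^k : (yq ^ k) ≋ (y ^ k · q^ k)
  yq^k = S.trans (^-distrib-· y (q^ 1) k) (S.*-congˡ (S.trans (mono-^ Z.1ℤ 1 0 0 k)
    (mono-cong (ZP.^-zeroˡ k) (NP.*-identityʳ k) (NP.*-zeroʳ k) (NP.*-zeroʳ k))))

durfeeSum-suc : ∀ N y → Ord≥ 1 y →
  durfeeSum (suc N) y ≋ (durfeeSum N y ⊕ (y · q^ N · invS (oneS ⊖ y)) · durfeeSum N (y · q^ 1))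
durfeeSum-suc N y y≈0 = S.trans
  (∑ₛ.∑-recurrence N (durfeeTerm N y) (durfeeTerm (suc N) y) (λ k → W · durfeeTerm N (y · q^ 1) k)
    S.refl (durfeeTerm-suc N y y≈0) top-term-vanishes)
  (⊕-congˡ (durfeeSum N y) (S.sym (∑ₛ.∑-*ˡ (suc N) W (durfeeTerm N (y · q^ 1)))))
  where
  W = y · q^ N · invS (oneS ⊖ y)
  top-term-vanishes : durfeeTerm N y (suc N) ≋ zeroS
  top-term-vanishes = S.trans (S.*-congʳ (S.*-congʳ (S.*-congʳ (qBinomial-over N (suc N) (NP.n<1+n N)))))
    (S.trans (S.*-congʳ (S.*-congʳ (S.zeroˡ _))) (S.trans (S.*-congʳ (S.zeroˡ _)) (S.zeroˡ _)))

qPoch-·-durfeeSum : ∀ N y → Ord≥ 1 y → (qPoch y N · durfeeSum N y) ≋ oneS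
qPoch-·-durfeeSum zero y y≈0 = S.trans (S.*-identityˡ _) (S.trans (S.+-identityˡ _)
  (S.trans (S.*-cong (S.trans (S.*-identityʳ (oneS · oneS)) (S.*-identityˡ oneS)) invS-oneS) (S.*-identityˡ oneS)))
qPoch-·-durfeeSum (suc N) y y≈0 = begin
  qPoch y (suc N) · durfeeSum (suc N) y
    ≈⟨ S.*-congˡ (durfeeSum-suc N y y≈0) ⟩
  qPoch y (suc N) · (durfeeSum N y ⊕ W · durfeeSum N yq)
    ≈⟨ S.distribˡ (qPoch y (suc N)) (durfeeSum N y) (W · durfeeSum N yq) ⟩
  qPoch y (suc N) · durfeeSum N y ⊕ qPoch y (suc N) · (W · durfeeSum N yq)
    ≈⟨ S.+-cong old-terms new-terms ⟩
  (oneS ⊖ Y) · oneS ⊕ Y · oneS · oneS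
    ≈⟨ cancel Y ⟩
  oneS ∎
  where
  open SetoidReasoning S.setoid
  yq = y · q^ 1
  Y = y · q^ N
  W = Y · invS (oneS ⊖ y)
  old-terms : (qPoch y (suc N) · durfeeSum N y) ≋ ((oneS ⊖ Y) · oneS)
  old-terms = S.trans (swap (qPoch y N) (oneS ⊖ Y) (durfeeSum N y)) (S.*-congˡ (qPoch-·-durfeeSum N y y≈0))
    where
    swap : ∀ p f d → ((p · f) · d) ≋ (f · (p · d))
    swap = solve 3 (λ p f d → ((p :* f) :* d) := (f :* (p :* d))) S.refl
  new-terms : (qPoch y (suc N) · (W · durfeeSum N yq)) ≋ (Y · oneS · oneS)
  new-terms = S.trans (S.*-congʳ (qPoch-unconsˡ y N))
    (S.trans (regroup (oneS ⊖ y) (qPoch yq N) Y (invS (oneS ⊖ y)) (durfeeSum N yq))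
      (S.*-cong (S.*-congˡ (invS-inverseʳ (const-1-⊖ y≈0))) (qPoch-·-durfeeSum N yq (Ord≥-1-·q y))))
    where
    regroup : ∀ a p y i d → ((a · p) · (y · i · d)) ≋ (y · (a · i) · (p · d))
    regroup = solve 5 (λ a p y i d → ((a :* p) :* (y :* i :* d)) := (y :* (a :* i) :* (p :* d))) S.refl
  cancel : ∀ y → ((oneS ⊖ y) · oneS ⊕ y · oneS · oneS) ≋ oneS
  cancel = solve 1 (λ y → ((con Z.1ℤ :- y) :* con Z.1ℤ :+ y :* con Z.1ℤ :* con Z.1ℤ) := con Z.1ℤ) S.refl

-- The common limit of both sides
t₂q[_] : ℕ → Series
t₂q[ a ] = mono Z.1ℤ (suc a) 0 1

Ord≥-1-t₂q[] : ∀ a → Ord≥ 1 t₂q[ a ]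
Ord≥-1-t₂q[] a = Ord≥-weaken (s≤s z≤n) (Ord≥-mono Z.1ℤ (suc a) 0 1)

t₁Part : ℕ → Series
t₁Part j = mono Z.1ℤ (choose2 (suc j)) j 0

t₂Part : ℕ → Series
t₂Part a = mono Z.1ℤ (a N.* a) 0 a

Ord≥-t₁Part : ∀ j → Ord≥ j (t₁Part j)
Ord≥-t₁Part j = Ord≥-weaken (NP.≤-trans (NP.m≤n+m j (choose2 (suc j))) (NP.m≤m+n _ 0)) (Ord≥-mono Z.1ℤ (choose2 (suc j)) j 0)

Ord≥-t₂Part : ∀ a → Ord≥ a (t₂Part a)
Ord≥-t₂Part a = Ord≥-weaken (NP.m≤n+m a _) (Ord≥-mono Z.1ℤ (a N.* a) 0 a)

limitTerm : ℕ → ℕ → Series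
limitTerm j a = t₁Part j · t₂Part a · qFac⁻¹ j · qFac⁻¹ a · invS (qPoch t₂q[ 0 ] a)

Ord≥-limitTerm : ∀ j a → Ord≥ (j N.+ a) (limitTerm j a)
Ord≥-limitTerm j a =
  Ord≥-·ˡ (j N.+ a) _ (Ord≥-·ˡ (j N.+ a) _ (Ord≥-·ˡ (j N.+ a) _ (Ord≥-· j a (Ord≥-t₁Part j) (Ord≥-t₂Part a))))

limitBox : ℕ → Series
limitBox n = ∑ₛ.∑ n (λ j → ∑ₛ.∑ n (limitTerm j))

limitTriangle : ℕ → Series
limitTriangle m = ∑ₛ.∑ (suc m) (λ j → ∑ₛ.∑ (suc (m ∸ j)) (limitTerm j))

-- The left-hand side
qMultinomial₃≋ : ∀ n k₁ k₂ k₃ → qMultinomial₃ n k₁ k₂ k₃ ≋ (qFac n · qFac⁻¹ k₁ · qFac⁻¹ k₂ · qFac⁻¹ k₃)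
qMultinomial₃≋ n k₁ k₂ k₃ = ⊛≋· (⊛≋· (⊛≋· (poch≋qPoch (q^ 1) n) (inv k₁)) (inv k₂)) (inv k₃)
  where
  inv = invS-poch (Ord≥-1-q^-suc 0)

summand≋ : ∀ n j k → n ≤ j N.+ k → summand n j k ≋
  (mono (signℤ (j N.+ k N.+ n)) (expo n j k) j k
    · (qFac n · qFac⁻¹ (n ∸ j) · qFac⁻¹ (n ∸ k) · qFac⁻¹ (j N.+ k ∸ n))
    · (invS (qPoch t₂q[ 0 ] n) · qFac⁻¹ n))
summand≋ n j k n≤j+k = S.trans (S.reflexive (if-true (dec-true (n N.≤? j N.+ k) n≤j+k)))
  (⊛≋· (⊛≋· S.refl (qMultinomial₃≋ n (n ∸ j) (n ∸ k) (j N.+ k ∸ n))) denominator)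
  where
  denominator : invS (poch t₂q[ 0 ] n ⊛ poch (q^ 1) n) ≋ (invS (qPoch t₂q[ 0 ] n) · qFac⁻¹ n)
  denominator = S.trans
    (invS-cong (P.subst (λ h → const h ≡ Z.1ℤ) (P.sym (⊛≡· (poch t₂q[ 0 ] n) (poch (q^ 1) n)))
                 (const-·-1 (const-poch (Ord≥-1-t₂q[] 0) n) (const-poch (Ord≥-1-q^-suc 0) n)))
      (⊛≋· (poch≋qPoch t₂q[ 0 ] n) (poch≋qPoch (q^ 1) n)))
    (invS-· (const-qPoch (Ord≥-1-t₂q[] 0) n) (const-qFac n))

summand-vanishes : ∀ n j k → j N.+ k < n → summand n j k ≋ zeroS
summand-vanishes n j k j+k<n = S.reflexive (if-false (dec-false (n N.≤? j N.+ k) (NP.<⇒≱ j+k<n)))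

Ord≥-summand : ∀ n j k → Ord≥ n (summand n j k)
Ord≥-summand n j k = case n N.≤? j N.+ k of λ
  { (yes n≤j+k) → Ord≥-≋ (summand≋ n j k n≤j+k)
                    (Ord≥-·ˡ n _ (Ord≥-·ˡ n _ (Ord≥-weaken (n≤deg n≤j+k) (Ord≥-mono _ (expo n j k) j k))))
  ; (no  n≰j+k) → Ord≥-≋ (summand-vanishes n j k (NP.≰⇒> n≰j+k)) ≈[]-refl
  }
  where
  n≤deg : n ≤ j N.+ k → n ≤ expo n j k N.+ j N.+ k
  n≤deg n≤j+k = P.subst (n ≤_) (P.sym (NP.+-assoc (expo n j k) j k)) (NP.≤-trans n≤j+k (NP.m≤n+m (j N.+ k) (expo n j k)))

lhsPartial-stable : ∀ N d a b c → a N.+ b N.+ c < N → lhsPartial (N N.+ d) a b c ≡ lhsPartial N a b c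
lhsPartial-stable N d a b c deg<N = sumℤ-extend N d _ (λ n N≤n →
  Ord≥-sumS (suc n) (λ j _ → Ord≥-sumS (suc n) (λ k _ → Ord≥-summand n j k)) a b c (NP.<-≤-trans deg<N N≤n))

expo-shift : ∀ j a c → expo (j N.+ a) j (a N.+ c) ≡ (choose2 (suc j) N.+ a N.* a) N.+ (choose2 c N.+ c N.* suc a)
expo-shift j a c = begin
  (choose2 (j N.+ a) N.+ choose2 (suc (a N.+ c)) N.+ j N.* j N.+ j) ∸ (j N.+ a) N.* j
    ≡⟨ P.cong (_∸ (j N.+ a) N.* j) expand ⟩
  (X N.+ (j N.+ a) N.* j) ∸ (j N.+ a) N.* j
    ≡⟨ NP.m+n∸n≡m X ((j N.+ a) N.* j) ⟩
  X ∎
  where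
  open P.≡-Reasoning
  X = (choose2 (suc j) N.+ a N.* a) N.+ (choose2 c N.+ c N.* suc a)
  rearrange : ∀ Cj Ca Cc j a c → Cj N.+ Ca N.+ j N.* a N.+ (Ca N.+ Cc N.+ a N.* c N.+ (a N.+ c)) N.+ j N.* j N.+ j
              ≡ (Cj N.+ j N.+ (Ca N.+ Ca N.+ a) N.+ (Cc N.+ c N.* suc a)) N.+ (j N.+ a) N.* j
  rearrange = ℕ-Solver.solve-∀
  expand : choose2 (j N.+ a) N.+ choose2 (suc (a N.+ c)) N.+ j N.* j N.+ j ≡ X N.+ (j N.+ a) N.* j
  expand rewrite choose2-+ j a | choose2-suc (a N.+ c) | choose2-+ a c | choose2-suc j | P.sym (choose2-double a) =
    rearrange (choose2 j) (choose2 a) (choose2 c) j a c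

signℤ-shift : ∀ j a c → signℤ (j N.+ (a N.+ c) N.+ (j N.+ a)) ≡ signℤ c
signℤ-shift j a c = begin
  signℤ (j N.+ (a N.+ c) N.+ (j N.+ a))        ≡⟨ P.cong signℤ (regroup j a c) ⟩
  signℤ (c N.+ ((j N.+ a) N.+ (j N.+ a)))      ≡⟨ signℤ-+ c _ ⟩
  signℤ c Z.* signℤ ((j N.+ a) N.+ (j N.+ a))  ≡⟨ P.cong (signℤ c Z.*_) (signℤ-double (j N.+ a)) ⟩
  signℤ c Z.* Z.1ℤ                             ≡⟨ ZP.*-identityʳ (signℤ c) ⟩
  signℤ c                                      ∎
  where
  open P.≡-Reasoning
  regroup : ∀ j a c → j N.+ (a N.+ c) N.+ (j N.+ a) ≡ c N.+ ((j N.+ a) N.+ (j N.+ a))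
  regroup = ℕ-Solver.solve-∀

summand-mono : ∀ j a c → mono (signℤ (j N.+ (a N.+ c) N.+ (j N.+ a))) (expo (j N.+ a) j (a N.+ c)) j (a N.+ c)
                         ≋ ((t₁Part j · t₂Part a) · (rotheCoeff c · t₂q[ a ] ^ c))
summand-mono j a c = S.sym (begin
  (t₁Part j · t₂Part a) · (rotheCoeff c · t₂q[ a ] ^ c)
    ≈⟨ S.*-cong (mono-·-mono Z.1ℤ _ j 0 Z.1ℤ _ 0 a) (S.*-congˡ (mono-^ Z.1ℤ (suc a) 0 1 c)) ⟩
  mono Z.1ℤ e (j N.+ 0) a · (rotheCoeff c · mono (Z.1ℤ Z.^ c) (c N.* suc a) (c N.* 0) (c N.* 1))
    ≈⟨ S.*-congˡ (mono-·-mono (signℤ c) (choose2 c) 0 0 (Z.1ℤ Z.^ c) (c N.* suc a) (c N.* 0) (c N.* 1)) ⟩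
  mono Z.1ℤ e (j N.+ 0) a · mono (signℤ c Z.* Z.1ℤ Z.^ c) (choose2 c N.+ c N.* suc a) (c N.* 0) (c N.* 1)
    ≈⟨ mono-·-mono Z.1ℤ e (j N.+ 0) a _ _ (c N.* 0) (c N.* 1) ⟩
  mono (Z.1ℤ Z.* (signℤ c Z.* Z.1ℤ Z.^ c)) _ (j N.+ 0 N.+ c N.* 0) (a N.+ c N.* 1)
    ≈⟨ mono-cong sign (P.sym (expo-shift j a c)) (t₁-degree j c) (P.cong (a N.+_) (NP.*-identityʳ c)) ⟩
  mono (signℤ (j N.+ (a N.+ c) N.+ (j N.+ a))) (expo (j N.+ a) j (a N.+ c)) j (a N.+ c) ∎)
  where
  open SetoidReasoning S.setoid
  e = choose2 (suc j) N.+ a N.* a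
  t₁-degree : ∀ j c → j N.+ 0 N.+ c N.* 0 ≡ j
  t₁-degree = ℕ-Solver.solve-∀
  sign : Z.1ℤ Z.* (signℤ c Z.* Z.1ℤ Z.^ c) ≡ signℤ (j N.+ (a N.+ c) N.+ (j N.+ a))
  sign = P.trans (ZP.*-identityˡ _) (P.trans (P.cong (signℤ c Z.*_) (ZP.^-zeroˡ c))
           (P.trans (ZP.*-identityʳ (signℤ c)) (P.sym (signℤ-shift j a c))))

summand-split : ∀ j a c → c ≤ j → summand (j N.+ a) j (a N.+ c) ≋
  ((t₁Part j · t₂Part a) · rotheTerm j t₂q[ a ] c · (qFac⁻¹ a · qFac⁻¹ j · invS (qPoch t₂q[ 0 ] (j N.+ a))))
summand-split j a c c≤j = begin
  summand n j (a N.+ c)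
    ≈⟨ summand≋ n j (a N.+ c) (P.subst (n ≤_) (NP.+-assoc j a c) (NP.m≤m+n n c)) ⟩
  _ · (qFac n · qFac⁻¹ (n ∸ j) · qFac⁻¹ (n ∸ (a N.+ c)) · qFac⁻¹ (j N.+ (a N.+ c) ∸ n)) · (J · qFac⁻¹ n)
    ≈⟨ S.*-congʳ (S.*-cong (summand-mono j a c) (S.reflexive denominators)) ⟩
  (M · (s · Z)) · (qFac n · qFac⁻¹ a · qFac⁻¹ (j ∸ c) · qFac⁻¹ c) · (J · qFac⁻¹ n)
    ≈⟨ regroup M s Z (qFac n) (qFac⁻¹ a) (qFac⁻¹ (j ∸ c)) (qFac⁻¹ c) J (qFac⁻¹ n) ⟩
  (qFac n · qFac⁻¹ n) · ((qFac⁻¹ c · qFac⁻¹ (j ∸ c)) · (M · s · Z · qFac⁻¹ a · J))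
    ≈⟨ S.*-cong (invS-inverseʳ (const-qFac n)) (S.*-congʳ (qFac⁻¹-· j c c≤j)) ⟩
  oneS · ((qBinomial j c · qFac⁻¹ j) · (M · s · Z · qFac⁻¹ a · J))
    ≈⟨ regroup′ M s Z (qFac⁻¹ a) J (qBinomial j c) (qFac⁻¹ j) ⟩
  M · rotheTerm j t₂q[ a ] c · (qFac⁻¹ a · qFac⁻¹ j · J) ∎
  where
  open SetoidReasoning S.setoid
  n = j N.+ a
  M = t₁Part j · t₂Part a
  s = rotheCoeff c
  Z = t₂q[ a ] ^ c
  J = invS (qPoch t₂q[ 0 ] n)
  denominators : (qFac n · qFac⁻¹ (n ∸ j) · qFac⁻¹ (n ∸ (a N.+ c)) · qFac⁻¹ (j N.+ (a N.+ c) ∸ n))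
               ≡ (qFac n · qFac⁻¹ a · qFac⁻¹ (j ∸ c) · qFac⁻¹ c)
  denominators rewrite NP.m+n∸m≡n j a
                     | P.trans (P.cong (_∸ (a N.+ c)) (NP.+-comm j a)) (NP.[m+n]∸[m+o]≡n∸o a j c)
                     | P.trans (P.cong (_∸ n) (P.sym (NP.+-assoc j a c))) (NP.m+n∸m≡n n c) = P.refl
  regroup : ∀ m s z p ia ib ic u v →
    ((m · (s · z)) · (p · ia · ib · ic) · (u · v)) ≋ ((p · v) · ((ic · ib) · (m · s · z · ia · u)))
  regroup = solve 9 (λ m s z p ia ib ic u v →
    ((m :* (s :* z)) :* (p :* ia :* ib :* ic) :* (u :* v)) := ((p :* v) :* ((ic :* ib) :* (m :* s :* z :* ia :* u)))) S.refl
  regroup′ : ∀ m s z ia u b ij → (oneS · ((b · ij) · (m · s · z · ia · u))) ≋ (m · (s · b · z) · (ia · ij · u))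
  regroup′ = solve 7 (λ m s z ia u b ij →
    (con Z.1ℤ :* ((b :* ij) :* (m :* s :* z :* ia :* u))) := (m :* (s :* b :* z) :* (ia :* ij :* u))) S.refl

summand-column : ∀ j a → ∑ₛ.∑ (suc j) (λ c → summand (j N.+ a) j (a N.+ c)) ≋ limitTerm j a
summand-column j a = begin
  ∑ₛ.∑ (suc j) (λ c → summand (j N.+ a) j (a N.+ c))
    ≈⟨ ∑ₛ.∑-cong< (suc j) (λ c c≤j → summand-split j a c (NP.≤-pred c≤j)) ⟩
  ∑ₛ.∑ (suc j) (λ c → M · rotheTerm j t₂q[ a ] c · R)
    ≈⟨ ∑ₛ.∑-*ʳ (suc j) R (λ c → M · rotheTerm j t₂q[ a ] c) ⟨
  ∑ₛ.∑ (suc j) (λ c → M · rotheTerm j t₂q[ a ] c) · R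
    ≈⟨ S.*-congʳ (S.trans (S.sym (∑ₛ.∑-*ˡ (suc j) M (rotheTerm j t₂q[ a ]))) (S.*-congˡ (S.sym (rothe j t₂q[ a ])))) ⟩
  (M · qPoch t₂q[ a ] j) · (qFac⁻¹ a · qFac⁻¹ j · invS (qPoch t₂q[ 0 ] (j N.+ a)))
    ≈⟨ S.*-congˡ (S.*-congˡ invS-qPoch-split) ⟩
  (M · qPoch t₂q[ a ] j) · (qFac⁻¹ a · qFac⁻¹ j · (invS (qPoch t₂q[ 0 ] a) · invS (qPoch t₂q[ a ] j)))
    ≈⟨ regroup M (qPoch t₂q[ a ] j) (qFac⁻¹ a) (qFac⁻¹ j) (invS (qPoch t₂q[ 0 ] a)) (invS (qPoch t₂q[ a ] j)) ⟩
  (qPoch t₂q[ a ] j · invS (qPoch t₂q[ a ] j)) · limitTerm j a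
    ≈⟨ S.*-congʳ (invS-inverseʳ (const-qPoch (Ord≥-1-t₂q[] a) j)) ⟩
  oneS · limitTerm j a
    ≈⟨ S.*-identityˡ (limitTerm j a) ⟩
  limitTerm j a ∎
  where
  open SetoidReasoning S.setoid
  M = t₁Part j · t₂Part a
  R = qFac⁻¹ a · qFac⁻¹ j · invS (qPoch t₂q[ 0 ] (j N.+ a))
  qPoch-split : qPoch t₂q[ 0 ] (j N.+ a) ≋ (qPoch t₂q[ 0 ] a · qPoch t₂q[ a ] j)
  qPoch-split = S.trans (S.reflexive (P.cong (qPoch t₂q[ 0 ]) (NP.+-comm j a)))
    (S.trans (qPoch-+ t₂q[ 0 ] a j) (S.*-congˡ (qPoch-cong j (mono-·-mono Z.1ℤ 1 0 1 Z.1ℤ a 0 0))))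
  invS-qPoch-split : invS (qPoch t₂q[ 0 ] (j N.+ a)) ≋ (invS (qPoch t₂q[ 0 ] a) · invS (qPoch t₂q[ a ] j))
  invS-qPoch-split = S.trans (invS-cong (const-qPoch (Ord≥-1-t₂q[] 0) (j N.+ a)) qPoch-split)
    (invS-· (const-qPoch (Ord≥-1-t₂q[] 0) a) (const-qPoch (Ord≥-1-t₂q[] a) j))
  regroup : ∀ m p ia ij u v → ((m · p) · (ia · ij · (u · v))) ≋ ((p · v) · (m · ij · ia · u))
  regroup = solve 6 (λ m p ia ij u v → ((m :* p) :* (ia :* ij :* (u :* v))) := ((p :* v) :* (m :* ij :* ia :* u))) S.refl

summand-row : ∀ j a → ∑ₛ.∑ (suc (j N.+ a)) (summand (j N.+ a) j) ≋ limitTerm j a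
summand-row j a = begin
  ∑ₛ.∑ (suc (j N.+ a)) (summand (j N.+ a) j)
    ≡⟨ P.cong (λ e → ∑ₛ.∑ e (summand (j N.+ a) j)) (P.trans (P.cong suc (NP.+-comm j a)) (P.sym (NP.+-suc a j))) ⟩
  ∑ₛ.∑ (a N.+ suc j) (summand (j N.+ a) j)
    ≈⟨ ∑ₛ.∑-split a (suc j) (summand (j N.+ a) j) ⟩
  ∑ₛ.∑ a (summand (j N.+ a) j) ⊕ ∑ₛ.∑ (suc j) (λ c → summand (j N.+ a) j (a N.+ c))
    ≈⟨ S.+-cong (∑ₛ.∑-zero a (λ k k<a → summand-vanishes (j N.+ a) j k (NP.+-monoʳ-< j k<a))) (summand-column j a) ⟩
  zeroS ⊕ limitTerm j a
    ≈⟨ S.+-identityˡ (limitTerm j a) ⟩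
  limitTerm j a ∎
  where open SetoidReasoning S.setoid

lhsPartial≋limitTriangle : ∀ m → lhsPartial (suc m) ≋ limitTriangle m
lhsPartial≋limitTriangle m = begin
  lhsPartial (suc m)
    ≈⟨ S.trans (sumS≋∑ (suc m) _) (∑ₛ.∑-cong (suc m) (λ n → S.trans (sumS≋∑ (suc n) _)
         (∑ₛ.∑-cong (suc n) (λ j → sumS≋∑ (suc n) (summand n j))))) ⟩
  ∑ₛ.∑ (suc m) (λ n → ∑ₛ.∑ (suc n) (λ j → row n j))
    ≈⟨ ∑ₛ.∑-triangle m row ⟩
  ∑ₛ.∑ (suc m) (λ j → ∑ₛ.∑ (suc (m ∸ j)) (λ a → row (j N.+ a) j))
    ≈⟨ ∑ₛ.∑-cong (suc m) (λ j → ∑ₛ.∑-cong (suc (m ∸ j)) (summand-row j)) ⟩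
  limitTriangle m ∎
  where
  open SetoidReasoning S.setoid
  row : ℕ → ℕ → Series
  row n j = ∑ₛ.∑ (suc n) (summand n j)

limitTriangle-≈[]-limitBox : ∀ m → limitTriangle m ≈[ suc m ] limitBox (suc (suc m))
limitTriangle-≈[]-limitBox m = ≈[]-trans
  (≈[]-∑ (suc m) (λ j j≤m → row-extend j (NP.≤-pred j≤m)))
  (∑-≈[]-snoc (suc m) _ (Ord≥-∑ (suc (suc m)) (λ a _ → Ord≥-weaken (NP.m≤m+n (suc m) a) (Ord≥-limitTerm (suc m) a))))
  where
  row-extend : ∀ j → j ≤ m → ∑ₛ.∑ (suc (m ∸ j)) (limitTerm j) ≈[ suc m ] ∑ₛ.∑ (suc (suc m)) (limitTerm j)
  row-extend j j≤m = P.subst (λ e → ∑ₛ.∑ (suc (m ∸ j)) (limitTerm j) ≈[ suc m ] ∑ₛ.∑ e (limitTerm j)) width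
    (∑-≈[]-extend (suc (m ∸ j)) (suc j) (limitTerm j) (λ i _ → Ord≥-weaken (degree i) (Ord≥-limitTerm j (suc (m ∸ j) N.+ i))))
    where
    width : suc (m ∸ j) N.+ suc j ≡ suc (suc m)
    width = P.trans (NP.+-suc (suc (m ∸ j)) j) (P.cong (λ t → suc (suc t)) (NP.m∸n+n≡m j≤m))
    degree : ∀ i → suc m ≤ j N.+ (suc (m ∸ j) N.+ i)
    degree i = P.subst (_≤ j N.+ (suc (m ∸ j) N.+ i)) (P.trans (NP.+-suc j (m ∸ j)) (P.cong suc (NP.m+[n∸m]≡n j≤m)))
                 (NP.+-monoʳ-≤ j (NP.m≤m+n (suc (m ∸ j)) i))

-- The right-hand side
rotheTerm-t₁ : ∀ M j → rotheTerm M (mono Z.-1ℤ 1 1 0) j ≋ (qBinomial M j · t₁Part j)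
rotheTerm-t₁ M j = S.trans (swap (rotheCoeff j) (qBinomial M j) (mono Z.-1ℤ 1 1 0 ^ j)) (S.*-congˡ (begin
  rotheCoeff j · mono Z.-1ℤ 1 1 0 ^ j
    ≈⟨ S.*-congˡ (mono-^ Z.-1ℤ 1 1 0 j) ⟩
  rotheCoeff j · mono (Z.-1ℤ Z.^ j) (j N.* 1) (j N.* 1) (j N.* 0)
    ≈⟨ mono-·-mono (signℤ j) (choose2 j) 0 0 (Z.-1ℤ Z.^ j) (j N.* 1) (j N.* 1) (j N.* 0) ⟩
  mono (signℤ j Z.* Z.-1ℤ Z.^ j) (choose2 j N.+ j N.* 1) (j N.* 1) (j N.* 0)
    ≈⟨ mono-cong sign exponent (NP.*-identityʳ j) (NP.*-zeroʳ j) ⟩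
  t₁Part j ∎))
  where
  open SetoidReasoning S.setoid
  swap : ∀ s b w → (s · b · w) ≋ (b · (s · w))
  swap = solve 3 (λ s b w → (s :* b :* w) := (b :* (s :* w))) S.refl
  sign : signℤ j Z.* Z.-1ℤ Z.^ j ≡ Z.1ℤ
  sign = P.trans (P.cong (signℤ j Z.*_) (-1^≡signℤ j)) (P.trans (P.sym (signℤ-+ j j)) (signℤ-double j))
  exponent : choose2 j N.+ j N.* 1 ≡ choose2 (suc j)
  exponent = P.trans (P.cong (choose2 j N.+_) (NP.*-identityʳ j)) (P.sym (choose2-suc j))

durfeeTerm-t₂ : ∀ M a → durfeeTerm M t₂q[ 0 ] a ≋ (qBinomial M a · t₂Part a · invS (qPoch t₂q[ 0 ] a))
durfeeTerm-t₂ M a = S.*-congʳ (S.trans (S.*-assoc (qBinomial M a) (q^ twoChoose2 a) (t₂q[ 0 ] ^ a)) (S.*-congˡ (begin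
  q^ twoChoose2 a · t₂q[ 0 ] ^ a
    ≈⟨ S.*-congˡ (mono-^ Z.1ℤ 1 0 1 a) ⟩
  q^ twoChoose2 a · mono (Z.1ℤ Z.^ a) (a N.* 1) (a N.* 0) (a N.* 1)
    ≈⟨ mono-·-mono Z.1ℤ (twoChoose2 a) 0 0 (Z.1ℤ Z.^ a) (a N.* 1) (a N.* 0) (a N.* 1) ⟩
  mono (Z.1ℤ Z.* Z.1ℤ Z.^ a) (twoChoose2 a N.+ a N.* 1) (a N.* 0) (a N.* 1)
    ≈⟨ mono-cong (P.trans (ZP.*-identityˡ _) (ZP.^-zeroˡ a)) exponent (NP.*-zeroʳ a) (NP.*-identityʳ a) ⟩
  t₂Part a ∎)))
  where
  open SetoidReasoning S.setoid
  exponent : twoChoose2 a N.+ a N.* 1 ≡ a N.* a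
  exponent = P.trans (P.cong (twoChoose2 a N.+_) (NP.*-identityʳ a)) (choose2-double a)

rhsPartial-≈[]-limitBox : ∀ M → rhsPartial M ≈[ suc M ] limitBox (suc M)
rhsPartial-≈[]-limitBox M = begin
  rhsPartial M
    ≈⟨ ≋⇒≈[] (⊛≋· (poch≋qPoch t₁q M) (invS-poch (Ord≥-1-t₂q[] 0) M)) ⟩
  qPoch t₁q M · invS (qPoch t₂q[ 0 ] M)
    ≈⟨ ≋⇒≈[] (S.*-cong (S.trans (rothe M t₁q) (∑ₛ.∑-cong (suc M) (rotheTerm-t₁ M)))
                       (S.trans (S.sym (invS-unique (const-qPoch (Ord≥-1-t₂q[] 0) M)
                                                    (qPoch-·-durfeeSum M t₂q[ 0 ] (Ord≥-1-t₂q[] 0))))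
                                (∑ₛ.∑-cong (suc M) (durfeeTerm-t₂ M)))) ⟩
  ∑ₛ.∑ (suc M) (λ j → qBinomial M j · t₁Part j) · ∑ₛ.∑ (suc M) (λ a → qBinomial M a · t₂Part a · J a)
    ≈⟨ ≈[]-· (≈[]-∑ (suc M) (λ j j≤M → qBinomial-≈[]-qFac⁻¹ M j (NP.≤-pred j≤M) (t₁Part j) (Ord≥-t₁Part j)))
             (≈[]-∑ (suc M) (λ a a≤M →
               ≈[]-· (qBinomial-≈[]-qFac⁻¹ M a (NP.≤-pred a≤M) (t₂Part a) (Ord≥-t₂Part a)) (≈[]-refl {f = J a}))) ⟩
  ∑ₛ.∑ (suc M) (λ j → qFac⁻¹ j · t₁Part j) · ∑ₛ.∑ (suc M) (λ a → qFac⁻¹ a · t₂Part a · J a)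
    ≈⟨ ≋⇒≈[] (S.trans (∑ₛ.∑-*ʳ (suc M) _ _) (∑ₛ.∑-cong (suc M) (λ j → S.trans (∑ₛ.∑-*ˡ (suc M) _ _)
         (∑ₛ.∑-cong (suc M) (λ a → regroup (qFac⁻¹ j) (t₁Part j) (qFac⁻¹ a) (t₂Part a) (J a)))))) ⟩
  limitBox (suc M) ∎
  where
  open SetoidReasoning (≈[]-setoid (suc M))
  t₁q = mono Z.-1ℤ 1 1 0
  J = λ a → invS (qPoch t₂q[ 0 ] a)
  regroup : ∀ ij t₁ ia t₂ u → ((ij · t₁) · (ia · t₂ · u)) ≋ (t₁ · t₂ · ij · ia · u)
  regroup = solve 5 (λ ij t₁ ia t₂ u → ((ij :* t₁) :* (ia :* t₂ :* u)) := (t₁ :* t₂ :* ij :* ia :* u)) S.refl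

lhsPartial-≈[]-rhsPartial : ∀ m → lhsPartial (suc m) ≈[ suc m ] rhsPartial (suc m)
lhsPartial-≈[]-rhsPartial m = begin
  lhsPartial (suc m)           ≈⟨ ≋⇒≈[] (lhsPartial≋limitTriangle m) ⟩
  limitTriangle m              ≈⟨ limitTriangle-≈[]-limitBox m ⟩
  limitBox (suc (suc m))       ≈⟨ ≈[]-weaken (NP.n≤1+n (suc m)) (rhsPartial-≈[]-limitBox (suc m)) ⟨
  rhsPartial (suc m)           ∎
  where open SetoidReasoning (≈[]-setoid (suc m))

theorem5 : (a b c : ℕ) → ∃[ v ] ∃[ N ] ((M : ℕ) → N ≤ M →
    (lhsPartial M a b c ≡ v) × (rhsPartial M a b c ≡ v))
theorem5 a b c = lhsPartial N a b c , N , λ M N≤M → lhs-stable M N≤M , rhs-stable M N≤M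
  where
  N = suc (a N.+ b N.+ c)
  lhs-stable : ∀ M → N ≤ M → lhsPartial M a b c ≡ lhsPartial N a b c
  lhs-stable M N≤M = P.trans (P.cong (λ e → lhsPartial e a b c) (P.sym (NP.m+[n∸m]≡n N≤M)))
                             (lhsPartial-stable N (M ∸ N) a b c (NP.n<1+n _))
  rhs-stable : ∀ M → N ≤ M → rhsPartial M a b c ≡ lhsPartial N a b c
  rhs-stable (suc m) N≤M = P.trans (P.sym (lhsPartial-≈[]-rhsPartial m a b c N≤M)) (lhs-stable (suc m) N≤M)
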